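{- Let $\Delta=\langle r_0,r_1,r_2\mid r_0^2=r_1^2=r_2^2=1\rangle\cong C_2*C_2*C_2$ and let $\Delta^+$ be the subgroup of index $2$ in $\Delta$ consisting of the elements of even word-length in $r_0,r_1,r_2$; it is free of rank $2$, generated by $\rho_2=r_0r_1$ and $\rho_0=r_1r_2$. Every automorphism $\alpha$ of $\Delta$ leaves $\Delta^+$ invariant (since $\Delta^+$ is the unique torsion-free subgroup of index $2$ in $\Delta$), so restriction defines a homomorphism $\theta:{\rm Aut}\,\Delta\to{\rm Aut}\,\Delta^+$, $\alpha\mapsto\alpha|_{\Delta^+}$. Then $\theta$ is an isomorphism. -}

module Defs where

open import Data.Bool using (Bool; true; false; not; _∧_; if_then_else_; T)
open import Data.Bool.Properties using (not-involutive)
open import Data.Fin using (Fin; _≟_; zero; suc)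
open import Data.List using (List; []; _∷_; _++_; foldr)
open import Data.Product using (Σ; _,_; proj₁; proj₂)
open import Data.Unit using (tt)
open import Relation.Nullary.Decidable using (⌊_⌋)
open import Relation.Binary.PropositionalEquality
  using (_≡_; refl; cong; trans; sym; subst)

-- The group Δ = ⟨ r₀ , r₁ , r₂ | r₀² = r₁² = r₂² = 1 ⟩ ≅ C₂ * C₂ * C₂,
-- realised concretely by its normal forms: reduced words in the letters
-- 0,1,2 (no two adjacent letters equal).

Letter : Set
Letter = Fin 3

_==_ : Letter → Letter → Bool
a == b = ⌊ a ≟ b ⌋

reduced : List Letter → Bool
reduced []           = true
reduced (a ∷ [])     = true
reduced (a ∷ b ∷ w)  = not (a == b) ∧ reduced (b ∷ w)

push : Letter → List Letter → List Letter
push a []      = a ∷ []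
push a (b ∷ w) = if a == b then w else a ∷ b ∷ w

reduce : List Letter → List Letter
reduce = foldr push []

reduced-tail′ : ∀ b w → T (reduced (b ∷ w)) → T (reduced w)
reduced-tail′ b [] _ = tt
reduced-tail′ b (c ∷ w) p with not (b == c) | p
... | true  | q = q

reduced-push : ∀ a w → T (reduced w) → T (reduced (push a w))
reduced-push a []      _ = tt
reduced-push a (b ∷ w) p with a == b in eq
... | true  = reduced-tail′ b w p
... | false rewrite eq = p

reduce-reduced : ∀ w → T (reduced (reduce w))
reduce-reduced []      = tt
reduce-reduced (a ∷ w) = reduced-push a (reduce w) (reduce-reduced w)

Δ : Set
Δ = Σ (List Letter) (λ w → T (reduced w))

_·_ : Δ → Δ → Δ
(u , _) · (v , _) = reduce (u ++ v) , reduce-reduced (u ++ v)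

infixl 7 _·_

e : Δ
e = [] , tt

r : Letter → Δ
r i = (i ∷ []) , tt

evenL : List Letter → Bool
evenL []      = true
evenL (_ ∷ w) = not (evenL w)

even-push : ∀ a w → evenL (push a w) ≡ not (evenL w)
even-push a []      = refl
even-push a (b ∷ w) with a == b
... | true  = sym (not-involutive (evenL w))
... | false = refl

even-reduce : ∀ w → evenL (reduce w) ≡ evenL w
even-reduce []      = refl
even-reduce (a ∷ w) = trans (even-push a (reduce w)) (cong not (even-reduce w))

even-++ : ∀ u v → evenL (u ++ v) ≡ (if evenL u then evenL v else not (evenL v))
even-++ []      v = refl
even-++ (x ∷ u) v with evenL u | even-++ u v
... | true  | eq = cong not eq
... | false | eq = trans (cong not eq) (not-involutive (evenL v))

IsEven : Δ → Set
IsEven x = T (evenL (proj₁ x))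

even-· : ∀ x y → IsEven x → IsEven y → IsEven (x · y)
even-· (u , _) (v , _) p q =
  subst T (sym (trans (even-reduce (u ++ v)) (even-++ u v))) (lem (evenL u) p)
  where
  lem : ∀ b → T b → T (if b then evenL v else not (evenL v))
  lem true _ = q

Δ⁺ : Set
Δ⁺ = Σ Δ IsEven

_·⁺_ : Δ⁺ → Δ⁺ → Δ⁺
(x , p) ·⁺ (y , q) = x · y , even-· x y p q

ρ₂ ρ₀ : Δ
ρ₂ = r zero · r (suc zero)
ρ₀ = r (suc zero) · r (suc (suc zero))

record Aut (A : Set) (_∙_ : A → A → A) : Set where
  field
    fun   : A → A
    inv   : A → A
    hom   : ∀ x y → fun (x ∙ y) ≡ fun x ∙ fun y
    linv  : ∀ x → inv (fun x) ≡ x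
    rinv  : ∀ x → fun (inv x) ≡ x
open Aut public

_∘ᴬ_ : ∀ {A _∙_} → Aut A _∙_ → Aut A _∙_ → Aut A _∙_
_∘ᴬ_ {_∙_ = _∙_} α β = record
  { fun  = λ x → fun α (fun β x)
  ; inv  = λ x → inv β (inv α x)
  ; hom  = λ x y → trans (cong (fun α) (hom β x y)) (hom α (fun β x) (fun β y))
  ; linv = λ x → trans (cong (inv β) (linv α (fun β x))) (linv β x)
  ; rinv = λ x → trans (cong (fun α) (rinv β (inv α x))) (rinv α x)
  }

AutΔ : Set
AutΔ = Aut Δ _·_

AutΔ⁺ : Set
AutΔ⁺ = Aut Δ⁺ _·⁺_

-- "θ(α) = β", i.e. β is the restriction of α to Δ⁺:
-- for every x ∈ Δ⁺, β x = α x (as elements of Δ).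
Restricts : AutΔ → AutΔ⁺ → Set
Restricts α β = ∀ (x : Δ) (p : IsEven x) → proj₁ (fun β (x , p)) ≡ fun α x

module Submission where

-- An automorphism of Δ maps each rᵢ to an involution other than 1, and in Δ these have odd
-- length; so automorphisms preserve parity and restrict to Δ⁺. If α and α′ agree on Δ⁺, the
-- involutions s = α r₀ and s′ = α′ r₀ induce the same conjugation on Δ⁺, so s′s centralises Δ⁺
-- and is trivial, whence α = α′ on Δ⁺r₀ too. Conversely, conjugation by r₁ inverts both ρ₂ and
-- ρ₀, so an automorphism β of Δ⁺ extends to Δ by r₁ ↦ s as soon as an involution s inverts both
-- u = β ρ₂ and v = β ρ₀. Such an s exists by Nielsen reduction on the lengths of (u, v): a
-- length-decreasing Nielsen move transfers the property back, and a pair admitting none consists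
-- of two-letter words, which share a letter rᵢ inverting both.

open import Defs
open import Algebra.Bundles using (Group)
import Algebra.Properties.Group as GroupProperties
import Algebra.Solver.Monoid as MonoidSolver
open import Data.Bool using (Bool; true; false; not; T; if_then_else_)
open import Data.Bool.Properties using (not-involutive; T-irrelevant) renaming (_≟_ to Bool-≟)
open import Data.Empty using (⊥; ⊥-elim)
open import Data.Fin using (zero; suc; _≟_)
open import Data.Fin.Properties using (all?; any?)
open import Data.List using (List; []; _∷_; _++_; foldr; reverse; _ʳ++_; take; drop; length)
open import Data.List.Properties
  using (foldr-++; ++-identityʳ; ++-assoc; unfold-reverse; reverse-involutive; reverse-++; ʳ++-defn;
         length-reverse; length-drop; length-++; length-ʳ++; take++drop≡id; ∷-injective)
open import Data.List.Relation.Unary.All as All using (All; []; _∷_)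
open import Data.Nat using (ℕ; zero; suc; _+_; _∸_; _≤_; _<_; z≤n; s≤s; _≤?_; _<?_)
open import Data.Nat.Properties
  using (+-comm; +-suc; +-cancelʳ-≡; +-mono-<; +-mono-<-≤; +-mono-≤; +-mono-≤-<; +-monoʳ-<; +-monoʳ-≤;
         +-monoˡ-<; +-monoˡ-≤; 1+n≢0; <-≤-trans; <⇒≤; <⇒≱; m+n∸m≡n; m+n≤o⇒m≤o; m+n≤o⇒m≤o∸n; m<m+n;
         m<n+o⇒m∸n<o; m∸[m∸n]≡n; m∸n+n≡m; m∸n≤m; m≤n+m; n≮n; ≤-pred; ≤-reflexive; ≤-trans; ≰⇒>;
         module ≤-Reasoning)
open import Data.Nat.Induction using (<-rec)
open import Data.Product using (Σ; ∃; _,_; proj₁; proj₂; _×_; uncurry)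
open import Data.Product.Properties using (≡-dec)
open import Data.Sum using (_⊎_; inj₁; inj₂)
open import Data.Unit using (⊤; tt)
open import Function using (_∘_; mk⇔)
open import Level using (_⊔_)
open import Relation.Binary.Definitions using (DecidableEquality)
open import Relation.Binary.PropositionalEquality
  using (_≡_; refl; sym; trans; cong; cong₂; subst; subst₂; isEquivalence; module ≡-Reasoning)
import Relation.Binary.Reasoning.Setoid as SetoidReasoning
open import Relation.Nullary using (¬_; Dec; yes; no; does)
open import Relation.Nullary.Decidable
  using (isYes; isYes≗does; dec-true; dec-false; does-⇔; from-yes; ¬?; _→-dec_; _×-dec_; _⊎-dec_; recompute; T?)
open import Relation.Unary using (Decidable)

data Which : Set where
  one two : Which

-- A symbol (i , b) stands for the i-th generator, inverted when b is true.
Symbol : Set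
Symbol = Which × Bool

infix 9 _⁻

_⁻ : Symbol → Symbol
(i , b) ⁻ = i , not b

infix 4 _≟ₛ_

_≟ₛ_ : DecidableEquality Symbol
_≟ₛ_ = ≡-dec which-≟ Bool-≟
  where
  which-≟ : DecidableEquality Which
  which-≟ one one = yes refl
  which-≟ one two = no (λ ())
  which-≟ two one = no (λ ())
  which-≟ two two = yes refl

same-generator : ∀ x y → proj₁ x ≡ proj₁ y → ¬ y ≡ x ⁻ → y ≡ x
same-generator (i , false) (.i , false) refl _   = refl
same-generator (i , false) (.i , true)  refl y≢x = ⊥-elim (y≢x refl)
same-generator (i , true)  (.i , false) refl y≢x = ⊥-elim (y≢x refl)
same-generator (i , true)  (.i , true)  refl _   = refl

different-generators : ∀ x y → ¬ y ≡ x ⁻ → ¬ y ≡ x → ¬ proj₁ x ≡ proj₁ y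
different-generators x y y≢x⁻ y≢x eq = y≢x (same-generator x y eq y≢x⁻)

which-pigeonhole : ∀ {i j k : Which} → ¬ i ≡ k → ¬ j ≡ k → i ≡ j
which-pigeonhole {one} {one} _   _   = refl
which-pigeonhole {two} {two} _   _   = refl
which-pigeonhole {one} {two} {one} i≢k _ = ⊥-elim (i≢k refl)
which-pigeonhole {one} {two} {two} _ j≢k = ⊥-elim (j≢k refl)
which-pigeonhole {two} {one} {one} _ j≢k = ⊥-elim (j≢k refl)
which-pigeonhole {two} {one} {two} i≢k _ = ⊥-elim (i≢k refl)

around-letter : ∀ x y z → ¬ y ≡ x ⁻ → ¬ z ≡ y ⁻ → ¬ x ≡ y → ¬ z ≡ y → ¬ z ≡ x ⁻ →
                z ≡ x × ¬ proj₁ y ≡ proj₁ x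
around-letter x y z y≢x⁻ z≢y⁻ x≢y z≢y z≢x⁻ =
  same-generator x z (which-pigeonhole (gen-y≢gen-x ∘ sym) gen-z≢gen-y) z≢x⁻ , gen-y≢gen-x
  where
  gen-y≢gen-x : ¬ proj₁ y ≡ proj₁ x
  gen-y≢gen-x = different-generators x y y≢x⁻ (x≢y ∘ sym) ∘ sym
  gen-z≢gen-y : ¬ proj₁ z ≡ proj₁ y
  gen-z≢gen-y = different-generators y z z≢y⁻ z≢y ∘ sym

FreelyReduced : List Symbol → Set
FreelyReduced []          = ⊤
FreelyReduced (x ∷ [])    = ⊤
FreelyReduced (x ∷ y ∷ L) = ¬ y ≡ x ⁻ × FreelyReduced (y ∷ L)

pushSym : Symbol → List Symbol → List Symbol
pushSym x []      = x ∷ []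
pushSym x (y ∷ L) with y ≟ₛ x ⁻
... | yes _ = L
... | no _  = x ∷ y ∷ L

freeReduce : List Symbol → List Symbol
freeReduce = foldr pushSym []

freeReduce-reduced : ∀ L → FreelyReduced (freeReduce L)
freeReduce-reduced []      = tt
freeReduce-reduced (x ∷ L) = pushSym-reduced x (freeReduce L) (freeReduce-reduced L)
  where
  tail-reduced : ∀ y L → FreelyReduced (y ∷ L) → FreelyReduced L
  tail-reduced y []      _       = tt
  tail-reduced y (z ∷ L) (_ , r) = r
  pushSym-reduced : ∀ x L → FreelyReduced L → FreelyReduced (pushSym x L)
  pushSym-reduced x []      _ = tt
  pushSym-reduced x (y ∷ L) r with y ≟ₛ x ⁻
  ... | yes _  = tail-reduced y L r
  ... | no y≢x = y≢x , r

module GroupLemmas {c ℓ} (G : Group c ℓ) where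

  open Group G renaming (refl to ≈-refl; sym to ≈-sym; trans to ≈-trans)
  open GroupProperties G
  open SetoidReasoning setoid
  open MonoidSolver monoid using (solve; _⊜_; _⊕_)

  conj : Carrier → Carrier → Carrier
  conj g x = g ∙ x ∙ g ⁻¹

  conj-∙ : ∀ g x y → conj g x ∙ conj g y ≈ conj g (x ∙ y)
  conj-∙ g x y = begin
    g ∙ x ∙ g ⁻¹ ∙ (g ∙ y ∙ g ⁻¹)    ≈⟨ assoc (g ∙ x) (g ⁻¹) (g ∙ y ∙ g ⁻¹) ⟩
    g ∙ x ∙ (g ⁻¹ ∙ (g ∙ y ∙ g ⁻¹))  ≈⟨ ∙-congˡ (∙-congˡ (assoc g y (g ⁻¹))) ⟩
    g ∙ x ∙ (g ⁻¹ ∙ (g ∙ (y ∙ g ⁻¹))) ≈⟨ ∙-congˡ (\\-leftDividesʳ g (y ∙ g ⁻¹)) ⟩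
    g ∙ x ∙ (y ∙ g ⁻¹)                ≈⟨ assoc g x (y ∙ g ⁻¹) ⟩
    g ∙ (x ∙ (y ∙ g ⁻¹))              ≈⟨ ∙-congˡ (assoc x y (g ⁻¹)) ⟨
    g ∙ (x ∙ y ∙ g ⁻¹)                ≈⟨ assoc g (x ∙ y) (g ⁻¹) ⟨
    g ∙ (x ∙ y) ∙ g ⁻¹                ∎

  conj-ε : ∀ g → conj g ε ≈ ε
  conj-ε g = ≈-trans (∙-congʳ (identityʳ g)) (inverseʳ g)

  conj-⁻¹ : ∀ g x → conj g (x ⁻¹) ≈ conj g x ⁻¹
  conj-⁻¹ g x = inverseʳ-unique (conj g x) (conj g (x ⁻¹)) (begin
    conj g x ∙ conj g (x ⁻¹) ≈⟨ conj-∙ g x (x ⁻¹) ⟩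
    conj g (x ∙ x ⁻¹)        ≈⟨ ∙-congʳ (∙-congˡ (inverseʳ x)) ⟩
    conj g ε                 ≈⟨ conj-ε g ⟩
    ε                        ∎)

  conj-conj-⁻¹ : ∀ g x → conj g (conj (g ⁻¹) x) ≈ x
  conj-conj-⁻¹ g x = begin
    g ∙ (g ⁻¹ ∙ x ∙ g ⁻¹ ⁻¹) ∙ g ⁻¹  ≈⟨ ∙-congʳ (∙-congˡ (∙-congˡ (⁻¹-involutive g))) ⟩
    g ∙ (g ⁻¹ ∙ x ∙ g) ∙ g ⁻¹
      ≈⟨ solve 3 (λ g g′ x → (g ⊕ ((g′ ⊕ x) ⊕ g)) ⊕ g′ ⊜ ((g ⊕ g′) ⊕ x) ⊕ (g ⊕ g′)) ≈-refl g (g ⁻¹) x ⟩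
    g ∙ g ⁻¹ ∙ x ∙ (g ∙ g ⁻¹)        ≈⟨ ∙-cong (∙-congʳ (inverseʳ g)) (inverseʳ g) ⟩
    ε ∙ x ∙ ε                        ≈⟨ ≈-trans (identityʳ _) (identityˡ x) ⟩
    x                                ∎

  conj-⁻¹-conj : ∀ g x → conj (g ⁻¹) (conj g x) ≈ x
  conj-⁻¹-conj g x = begin
    g ⁻¹ ∙ (g ∙ x ∙ g ⁻¹) ∙ g ⁻¹ ⁻¹  ≈⟨ ∙-congˡ (⁻¹-involutive g) ⟩
    g ⁻¹ ∙ (g ∙ x ∙ g ⁻¹) ∙ g
      ≈⟨ solve 3 (λ g g′ x → (g′ ⊕ ((g ⊕ x) ⊕ g′)) ⊕ g ⊜ ((g′ ⊕ g) ⊕ x) ⊕ (g′ ⊕ g)) ≈-refl g (g ⁻¹) x ⟩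
    g ⁻¹ ∙ g ∙ x ∙ (g ⁻¹ ∙ g)        ≈⟨ ∙-cong (∙-congʳ (inverseˡ g)) (inverseˡ g) ⟩
    ε ∙ x ∙ ε                        ≈⟨ ≈-trans (identityʳ _) (identityˡ x) ⟩
    x                                ∎

  involution-⁻¹ : ∀ {s} → s ∙ s ≈ ε → s ⁻¹ ≈ s
  involution-⁻¹ {s} ss≈ε = ≈-sym (inverseʳ-unique s s ss≈ε)

  conj-involution : ∀ {s} → s ∙ s ≈ ε → ∀ x → conj s x ≈ s ∙ x ∙ s
  conj-involution ss≈ε x = ∙-congˡ (involution-⁻¹ ss≈ε)

  involution-∙-inverseˡ : ∀ {a b} → a ∙ a ≈ ε → b ∙ b ≈ ε → a ∙ (a ∙ b) ∙ a ≈ (a ∙ b) ⁻¹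
  involution-∙-inverseˡ {a} {b} aa≈ε bb≈ε = begin
    a ∙ (a ∙ b) ∙ a   ≈⟨ ∙-congʳ (assoc a a b) ⟨
    a ∙ a ∙ b ∙ a     ≈⟨ ∙-congʳ (≈-trans (∙-congʳ aa≈ε) (identityˡ b)) ⟩
    b ∙ a             ≈⟨ ∙-cong (involution-⁻¹ bb≈ε) (involution-⁻¹ aa≈ε) ⟨
    b ⁻¹ ∙ a ⁻¹       ≈⟨ ⁻¹-anti-homo-∙ a b ⟨
    (a ∙ b) ⁻¹        ∎

  involution-∙-inverseʳ : ∀ {a b} → a ∙ a ≈ ε → b ∙ b ≈ ε → b ∙ (a ∙ b) ∙ b ≈ (a ∙ b) ⁻¹
  involution-∙-inverseʳ {a} {b} aa≈ε bb≈ε = begin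
    b ∙ (a ∙ b) ∙ b   ≈⟨ ∙-congʳ (assoc b a b) ⟨
    b ∙ a ∙ b ∙ b     ≈⟨ assoc (b ∙ a) b b ⟩
    b ∙ a ∙ (b ∙ b)   ≈⟨ ≈-trans (∙-congˡ bb≈ε) (identityʳ (b ∙ a)) ⟩
    b ∙ a             ≈⟨ ∙-cong (involution-⁻¹ bb≈ε) (involution-⁻¹ aa≈ε) ⟨
    b ⁻¹ ∙ a ⁻¹       ≈⟨ ⁻¹-anti-homo-∙ a b ⟨
    (a ∙ b) ⁻¹        ∎

  record JointlyInverted (u v : Carrier) : Set (c ⊔ ℓ) where
    field
      s          : Carrier
      involutive : s ∙ s ≈ ε
      inverts₁   : s ∙ u ∙ s ≈ u ⁻¹
      inverts₂   : s ∙ v ∙ s ≈ v ⁻¹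

  open JointlyInverted

  inverts-⁻¹ : ∀ {s x} → s ∙ s ≈ ε → s ∙ x ∙ s ≈ x ⁻¹ → s ∙ x ⁻¹ ∙ s ≈ x ⁻¹ ⁻¹
  inverts-⁻¹ {s} {x} ss≈ε sxs≈x⁻¹ = begin
    s ∙ x ⁻¹ ∙ s     ≈⟨ conj-involution ss≈ε (x ⁻¹) ⟨
    conj s (x ⁻¹)    ≈⟨ conj-⁻¹ s x ⟩
    conj s x ⁻¹      ≈⟨ ⁻¹-cong (≈-trans (conj-involution ss≈ε x) sxs≈x⁻¹) ⟩
    x ⁻¹ ⁻¹          ∎

  JointlyInverted-resp : ∀ {u u′ v v′} → u ≈ u′ → v ≈ v′ →
                             JointlyInverted u v → JointlyInverted u′ v′
  JointlyInverted-resp u≈u′ v≈v′ I = record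
    { s          = s I
    ; involutive = involutive I
    ; inverts₁   = ≈-trans (∙-congʳ (∙-congˡ (≈-sym u≈u′))) (≈-trans (inverts₁ I) (⁻¹-cong u≈u′))
    ; inverts₂   = ≈-trans (∙-congʳ (∙-congˡ (≈-sym v≈v′))) (≈-trans (inverts₂ I) (⁻¹-cong v≈v′))
    }

  JointlyInverted-swap : ∀ {u v} → JointlyInverted u v → JointlyInverted v u
  JointlyInverted-swap I = record
    { s = s I ; involutive = involutive I ; inverts₁ = inverts₂ I ; inverts₂ = inverts₁ I }

  JointlyInverted-⁻¹ : ∀ {u v} → JointlyInverted u v → JointlyInverted (u ⁻¹) v
  JointlyInverted-⁻¹ I = record
    { s          = s I
    ; involutive = involutive I
    ; inverts₁   = inverts-⁻¹ (involutive I) (inverts₁ I)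
    ; inverts₂   = inverts₂ I
    }

  JointlyInverted-∙ : ∀ {u v} → JointlyInverted u v → JointlyInverted (u ∙ v) v
  JointlyInverted-∙ {u} {v} I = record
    { s          = t
    ; involutive = begin
        v ⁻¹ ∙ σ ∙ (v ⁻¹ ∙ σ)   ≈⟨ assoc (v ⁻¹) σ (v ⁻¹ ∙ σ) ⟩
        v ⁻¹ ∙ (σ ∙ (v ⁻¹ ∙ σ)) ≈⟨ ∙-congˡ (assoc σ (v ⁻¹) σ) ⟨
        v ⁻¹ ∙ (σ ∙ v ⁻¹ ∙ σ)   ≈⟨ ∙-congˡ (inverts-⁻¹ (involutive I) (inverts₂ I)) ⟩
        v ⁻¹ ∙ v ⁻¹ ⁻¹          ≈⟨ inverseʳ (v ⁻¹) ⟩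
        ε                       ∎
    ; inverts₁   = begin
        t ∙ (u ∙ v) ∙ t           ≈⟨ assoc t (u ∙ v) t ⟩
        t ∙ (u ∙ v ∙ (v ⁻¹ ∙ σ))  ≈⟨ ∙-congˡ (≈-trans (assoc u v (v ⁻¹ ∙ σ)) (∙-congˡ (\\-leftDividesˡ v σ))) ⟩
        t ∙ (u ∙ σ)               ≈⟨ assoc (v ⁻¹) σ (u ∙ σ) ⟩
        v ⁻¹ ∙ (σ ∙ (u ∙ σ))      ≈⟨ ∙-congˡ (≈-trans (≈-sym (assoc σ u σ)) (inverts₁ I)) ⟩
        v ⁻¹ ∙ u ⁻¹               ≈⟨ ⁻¹-anti-homo-∙ u v ⟨
        (u ∙ v) ⁻¹                ∎
    ; inverts₂   = begin
        t ∙ v ∙ t               ≈⟨ assoc t v t ⟩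
        t ∙ (v ∙ (v ⁻¹ ∙ σ))    ≈⟨ ∙-congˡ (\\-leftDividesˡ v σ) ⟩
        v ⁻¹ ∙ σ ∙ σ            ≈⟨ assoc (v ⁻¹) σ σ ⟩
        v ⁻¹ ∙ (σ ∙ σ)          ≈⟨ ∙-congˡ (involutive I) ⟩
        v ⁻¹ ∙ ε                ≈⟨ identityʳ (v ⁻¹) ⟩
        v ⁻¹                    ∎
    }
    where
    σ t : Carrier
    σ = s I
    t = v ⁻¹ ∙ σ

  JointlyInverted-conj : ∀ {u v} g → JointlyInverted u v →
                             JointlyInverted (conj g u) (conj g v)
  JointlyInverted-conj {u} {v} g I = record
    { s          = conj g (s I)
    ; involutive = ≈-trans (conj-∙ g (s I) (s I)) (≈-trans (∙-congʳ (∙-congˡ (involutive I))) (conj-ε g))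
    ; inverts₁   = inverts u (inverts₁ I)
    ; inverts₂   = inverts v (inverts₂ I)
    }
    where
    inverts : ∀ x → s I ∙ x ∙ s I ≈ x ⁻¹ → conj g (s I) ∙ conj g x ∙ conj g (s I) ≈ conj g x ⁻¹
    inverts x sxs≈x⁻¹ = begin
      conj g (s I) ∙ conj g x ∙ conj g (s I) ≈⟨ ∙-congʳ (conj-∙ g (s I) x) ⟩
      conj g (s I ∙ x) ∙ conj g (s I)        ≈⟨ conj-∙ g (s I ∙ x) (s I) ⟩
      conj g (s I ∙ x ∙ s I)                 ≈⟨ ∙-congʳ (∙-congˡ sxs≈x⁻¹) ⟩
      conj g (x ⁻¹)                          ≈⟨ conj-⁻¹ g x ⟩
      conj g x ⁻¹                            ∎

  JointlyInverted-⁻¹ʳ : ∀ {u v} → JointlyInverted u v → JointlyInverted u (v ⁻¹)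
  JointlyInverted-⁻¹ʳ I =
    JointlyInverted-swap (JointlyInverted-⁻¹ (JointlyInverted-swap I))

  -- The Nielsen moves (u, v) ↦ (u v, v) and (u, v) ↦ (u, u v), read backwards.
  JointlyInverted-∙⁻¹ˡ : ∀ {u v} → JointlyInverted (u ∙ v) v → JointlyInverted u v
  JointlyInverted-∙⁻¹ˡ {u} {v} I =
    JointlyInverted-resp ≈-refl (⁻¹-involutive v) (JointlyInverted-⁻¹ʳ
      (JointlyInverted-resp (//-rightDividesʳ v u) ≈-refl
        (JointlyInverted-∙ (JointlyInverted-⁻¹ʳ I))))

  JointlyInverted-∙⁻¹ʳ : ∀ {u v} → JointlyInverted u (u ∙ v) → JointlyInverted u v
  JointlyInverted-∙⁻¹ʳ {u} {v} I =
    JointlyInverted-resp ≈-refl (⁻¹-involutive v) (JointlyInverted-swap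
      (JointlyInverted-⁻¹ (JointlyInverted-resp [uv]⁻¹u≈v⁻¹ ≈-refl
        (JointlyInverted-∙ (JointlyInverted-⁻¹ (JointlyInverted-swap I))))))
    where
    [uv]⁻¹u≈v⁻¹ : (u ∙ v) ⁻¹ ∙ u ≈ v ⁻¹
    [uv]⁻¹u≈v⁻¹ = ≈-trans (∙-congʳ (⁻¹-anti-homo-∙ u v)) (//-rightDividesˡ u (v ⁻¹))

  signed : Bool → Carrier → Carrier
  signed false x = x
  signed true  x = x ⁻¹

  generator : Carrier → Carrier → Which → Carrier
  generator u v one = u
  generator u v two = v

  letter : Carrier → Carrier → Symbol → Carrier
  letter u v (i , b) = signed b (generator u v i)

  eval : Carrier → Carrier → List Symbol → Carrier
  eval u v []      = ε
  eval u v (x ∷ L) = letter u v x ∙ eval u v L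

  signed-not : ∀ b x → signed (not b) x ≈ signed b x ⁻¹
  signed-not false x = ≈-refl
  signed-not true  x = ≈-sym (⁻¹-involutive x)

  letter-⁻ : ∀ u v x → letter u v (x ⁻) ≈ letter u v x ⁻¹
  letter-⁻ u v (i , b) = signed-not b (generator u v i)

  eval-++ : ∀ u v L₁ L₂ → eval u v (L₁ ++ L₂) ≈ eval u v L₁ ∙ eval u v L₂
  eval-++ u v []       L₂ = ≈-sym (identityˡ _)
  eval-++ u v (x ∷ L₁) L₂ =
    ≈-trans (∙-congˡ (eval-++ u v L₁ L₂)) (≈-sym (assoc (letter u v x) (eval u v L₁) (eval u v L₂)))

  eval-conj : ∀ g u v L → eval (conj g u) (conj g v) L ≈ conj g (eval u v L)
  eval-conj g u v []      = ≈-sym (conj-ε g)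
  eval-conj g u v (x ∷ L) =
    ≈-trans (∙-cong (letter-conj x) (eval-conj g u v L)) (conj-∙ g (letter u v x) (eval u v L))
    where
    letter-conj : ∀ x → letter (conj g u) (conj g v) x ≈ conj g (letter u v x)
    letter-conj (one , false) = ≈-refl
    letter-conj (one , true)  = ≈-sym (conj-⁻¹ g u)
    letter-conj (two , false) = ≈-refl
    letter-conj (two , true)  = ≈-sym (conj-⁻¹ g v)

  InSpan : Carrier → Carrier → Carrier → Set ℓ
  InSpan u v x = ∃ λ L → eval u v L ≈ x

  span-resp : ∀ {u v x y} → x ≈ y → InSpan u v x → InSpan u v y
  span-resp x≈y (L , eq) = L , ≈-trans eq x≈y

  span-ε : ∀ {u v} → InSpan u v ε
  span-ε = [] , ≈-refl

  span-letter : ∀ {u v} x → InSpan u v (letter u v x)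
  span-letter x = x ∷ [] , identityʳ _

  span-∙ : ∀ {u v x y} → InSpan u v x → InSpan u v y → InSpan u v (x ∙ y)
  span-∙ {u} {v} (L₁ , eq₁) (L₂ , eq₂) = L₁ ++ L₂ , ≈-trans (eval-++ u v L₁ L₂) (∙-cong eq₁ eq₂)

  span-⁻¹ : ∀ {u v x} → InSpan u v x → InSpan u v (x ⁻¹)
  span-⁻¹ {u} {v} (L , eq) = span-resp (⁻¹-cong eq) (eval-⁻¹ L)
    where
    eval-⁻¹ : ∀ L → InSpan u v (eval u v L ⁻¹)
    eval-⁻¹ []      = span-resp (≈-sym ε⁻¹≈ε) span-ε
    eval-⁻¹ (x ∷ L) = span-resp (≈-sym (⁻¹-anti-homo-∙ (letter u v x) (eval u v L)))
      (span-∙ (eval-⁻¹ L) (span-resp (letter-⁻ u v x) (span-letter (x ⁻))))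

  span-⊆ : ∀ {u v u′ v′ x} → InSpan u′ v′ u → InSpan u′ v′ v → InSpan u v x → InSpan u′ v′ x
  span-⊆ {u} {v} {u′} {v′} u∈ v∈ (L , eq) = span-resp eq (eval-∈ L)
    where
    generator-∈ : ∀ i → InSpan u′ v′ (generator u v i)
    generator-∈ one = u∈
    generator-∈ two = v∈
    letter-∈ : ∀ x → InSpan u′ v′ (letter u v x)
    letter-∈ (i , false) = generator-∈ i
    letter-∈ (i , true)  = span-⁻¹ (generator-∈ i)
    eval-∈ : ∀ L → InSpan u′ v′ (eval u v L)
    eval-∈ []      = span-ε
    eval-∈ (x ∷ L) = span-∙ (letter-∈ x) (eval-∈ L)

  span-conj : ∀ {u v x} g → InSpan u v x → InSpan (conj g u) (conj g v) (conj g x)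
  span-conj {u} {v} g (L , eq) = L , ≈-trans (eval-conj g u v L) (∙-congʳ (∙-congˡ eq))

  eval-freeReduce : ∀ u v L → eval u v (freeReduce L) ≈ eval u v L
  eval-freeReduce u v []      = ≈-refl
  eval-freeReduce u v (x ∷ L) =
    ≈-trans (eval-pushSym x (freeReduce L)) (∙-congˡ (eval-freeReduce u v L))
    where
    eval-pushSym : ∀ x L → eval u v (pushSym x L) ≈ letter u v x ∙ eval u v L
    eval-pushSym x []      = ≈-refl
    eval-pushSym x (y ∷ L) with y ≟ₛ x ⁻
    ... | no _     = ≈-refl
    ... | yes refl = begin
      eval u v L                                  ≈⟨ \\-leftDividesˡ (letter u v x) (eval u v L) ⟨
      letter u v x ∙ (letter u v x ⁻¹ ∙ eval u v L) ≈⟨ ∙-congˡ (∙-congʳ (letter-⁻ u v x)) ⟨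
      letter u v x ∙ (letter u v (x ⁻) ∙ eval u v L) ∎

  freely-reduced-word : ∀ {u v x} → InSpan u v x → ∃ λ L → FreelyReduced L × eval u v L ≈ x
  freely-reduced-word {u} {v} (L , eq) =
    freeReduce L , freeReduce-reduced L , ≈-trans (eval-freeReduce u v L) eq

  Commute : Carrier → Carrier → Set ℓ
  Commute a b = a ∙ b ≈ b ∙ a

  commute-sym : ∀ {a b} → Commute a b → Commute b a
  commute-sym = ≈-sym

  commute-⁻¹ʳ : ∀ {a b} → Commute a b → Commute a (b ⁻¹)
  commute-⁻¹ʳ {a} {b} ab≈ba = begin
    a ∙ b ⁻¹                ≈⟨ \\-leftDividesʳ b (a ∙ b ⁻¹) ⟨
    b ⁻¹ ∙ (b ∙ (a ∙ b ⁻¹))  ≈⟨ ∙-congˡ (assoc b a (b ⁻¹)) ⟨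
    b ⁻¹ ∙ (b ∙ a ∙ b ⁻¹)    ≈⟨ ∙-congˡ (∙-congʳ ab≈ba) ⟨
    b ⁻¹ ∙ (a ∙ b ∙ b ⁻¹)    ≈⟨ ∙-congˡ (//-rightDividesʳ b a) ⟩
    b ⁻¹ ∙ a                 ∎

  commute-signedʳ : ∀ {a b} t → Commute a b → Commute a (signed t b)
  commute-signedʳ false ab≈ba = ab≈ba
  commute-signedʳ true  ab≈ba = commute-⁻¹ʳ ab≈ba

  commute-signed : ∀ {a b} s t → Commute a b → Commute (signed s a) (signed t b)
  commute-signed s t ab≈ba =
    commute-sym (commute-signedʳ s (commute-sym (commute-signedʳ t ab≈ba)))

  commute-∙ʳ : ∀ {a b c} → Commute a b → Commute a c → Commute a (b ∙ c)
  commute-∙ʳ {a} {b} {c} ab≈ba ac≈ca = begin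
    a ∙ (b ∙ c)  ≈⟨ assoc a b c ⟨
    a ∙ b ∙ c    ≈⟨ ∙-congʳ ab≈ba ⟩
    b ∙ a ∙ c    ≈⟨ assoc b a c ⟩
    b ∙ (a ∙ c)  ≈⟨ ∙-congˡ ac≈ca ⟩
    b ∙ (c ∙ a)  ≈⟨ assoc b c a ⟨
    b ∙ c ∙ a    ∎

  commute-eval : ∀ {a u v L} → All (λ x → Commute a (letter u v x)) L → Commute a (eval u v L)
  commute-eval {a} []       = ≈-trans (identityʳ a) (≈-sym (identityˡ a))
  commute-eval (c ∷ cs)     = commute-∙ʳ c (commute-eval cs)

  eval-commute : ∀ {u v} {P : Symbol → Set} →
                 (∀ {x y} → P x → P y → Commute (letter u v x) (letter u v y)) →
                 ∀ {L₁ L₂} → All P L₁ → All P L₂ → Commute (eval u v L₁) (eval u v L₂)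
  eval-commute commute ps₁ ps₂ =
    commute-eval (All.map (λ py → commute-sym (commute-eval (All.map (commute py) ps₁))) ps₂)

  conj-agree⇒commute : ∀ {s s′ y} → s ∙ s ≈ ε → s′ ∙ s′ ≈ ε →
                        s ∙ y ∙ s ≈ s′ ∙ y ∙ s′ → Commute (s′ ∙ s) y
  conj-agree⇒commute {s} {s′} {y} ss≈ε s′s′≈ε sys≈s′ys′ = begin
    s′ ∙ s ∙ y                 ≈⟨ ≈-trans (∙-congˡ ss≈ε) (identityʳ _) ⟨
    s′ ∙ s ∙ y ∙ (s ∙ s)       ≈⟨ solve 3 (λ s′ s y → ((s′ ⊕ s) ⊕ y) ⊕ (s ⊕ s) ⊜ (s′ ⊕ ((s ⊕ y) ⊕ s)) ⊕ s) ≈-refl s′ s y ⟩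
    s′ ∙ (s ∙ y ∙ s) ∙ s       ≈⟨ ∙-congʳ (∙-congˡ sys≈s′ys′) ⟩
    s′ ∙ (s′ ∙ y ∙ s′) ∙ s
      ≈⟨ solve 3 (λ s′ s y → (s′ ⊕ ((s′ ⊕ y) ⊕ s′)) ⊕ s ⊜ (s′ ⊕ s′) ⊕ (y ⊕ (s′ ⊕ s))) ≈-refl s′ s y ⟩
    s′ ∙ s′ ∙ (y ∙ (s′ ∙ s))   ≈⟨ ∙-congʳ s′s′≈ε ⟩
    ε ∙ (y ∙ (s′ ∙ s))         ≈⟨ identityˡ _ ⟩
    y ∙ (s′ ∙ s)               ∎

Word : Set
Word = List Letter

Reduced : Word → Set
Reduced w = T (reduced w)

third-letter : ∀ (a b : Letter) → ∃ λ c → ¬ c ≡ a × ¬ c ≡ b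
third-letter = from-yes (all? λ (a : Letter) → all? λ (b : Letter) → any? λ (c : Letter) →
  ¬? (c ≟ a) ×-dec ¬? (c ≟ b))

common-letter : ∀ (a b c d : Letter) → ¬ a ≡ b → ¬ c ≡ d →
                ∃ λ i → (i ≡ a ⊎ i ≡ b) × (i ≡ c ⊎ i ≡ d)
common-letter = from-yes (all? λ (a : Letter) → all? λ (b : Letter) → all? λ (c : Letter) → all? λ (d : Letter) →
  ¬? (a ≟ b) →-dec (¬? (c ≟ d) →-dec any? λ (i : Letter) → ((i ≟ a) ⊎-dec (i ≟ b)) ×-dec ((i ≟ c) ⊎-dec (i ≟ d))))

==-refl : ∀ a → (a == a) ≡ true
==-refl a = trans (isYes≗does (a ≟ a)) (dec-true (a ≟ a) refl)

==⇒≡ : ∀ {a b} → (a == b) ≡ true → a ≡ b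
==⇒≡ {a} {b} eq with a ≟ b
... | yes a≡b = a≡b
==⇒≡ () | no _

≢⇒==-false : ∀ {a b} → ¬ a ≡ b → (a == b) ≡ false
≢⇒==-false {a} {b} a≢b = trans (isYes≗does (a ≟ b)) (dec-false (a ≟ b) a≢b)

==-false⇒≢ : ∀ {a b} → (a == b) ≡ false → ¬ a ≡ b
==-false⇒≢ eq refl with trans (sym (==-refl _)) eq
... | ()

==-sym : ∀ a b → (a == b) ≡ (b == a)
==-sym a b = begin
  isYes (a ≟ b) ≡⟨ isYes≗does (a ≟ b) ⟩
  does (a ≟ b)  ≡⟨ does-⇔ (mk⇔ sym sym) (a ≟ b) (b ≟ a) ⟩
  does (b ≟ a)  ≡⟨ isYes≗does (b ≟ a) ⟨
  isYes (b ≟ a) ∎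
  where open ≡-Reasoning

Δ-ext : ∀ {x y : Δ} → proj₁ x ≡ proj₁ y → x ≡ y
Δ-ext {w , p} {.w , q} refl = cong (w ,_) (T-irrelevant p q)

reduced-∷∷⁻ : ∀ a b w → Reduced (a ∷ b ∷ w) → (a == b) ≡ false × Reduced (b ∷ w)
reduced-∷∷⁻ a b w p with a == b
... | false = refl , p

reduced-∷∷ : ∀ a b w → (a == b) ≡ false → Reduced (b ∷ w) → Reduced (a ∷ b ∷ w)
reduced-∷∷ a b w eq p rewrite eq = p

compatible : Word → Word → Bool
compatible (a ∷ _) (b ∷ _) = not (a == b)
compatible _       _       = true

reduced-head : ∀ a w → Reduced (a ∷ w) → T (compatible (a ∷ []) w)
reduced-head a []      _ = tt
reduced-head a (b ∷ w) p with a == b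
... | false = tt

push-fresh : ∀ a w → T (compatible (a ∷ []) w) → push a w ≡ a ∷ w
push-fresh a []      _ = refl
push-fresh a (b ∷ w) c with a == b
... | false = refl

push-push : ∀ a w → Reduced w → push a (push a w) ≡ w
push-push a []      _ rewrite ==-refl a = refl
push-push a (b ∷ w) p with a == b in eq
... | false rewrite ==-refl a = refl
... | true with ==⇒≡ eq
...   | refl = push-fresh a w (reduced-head a w p)

push-cancel : ∀ a w → push a (a ∷ w) ≡ w
push-cancel a w rewrite ==-refl a = refl

act : Word → Word → Word
act u v = foldr push v u

act-reduced : ∀ u v → Reduced v → Reduced (act u v)
act-reduced []      v p = p
act-reduced (a ∷ u) v p = reduced-push a (act u v) (act-reduced u v p)

act-push : ∀ a u v → Reduced v → act (push a u) v ≡ push a (act u v)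
act-push a []      v p = refl
act-push a (b ∷ u) v p with a == b in eq
... | false = refl
... | true with ==⇒≡ eq
...   | refl = sym (push-push a (act u v) (act-reduced u v p))

act-reduce : ∀ u v → Reduced v → act (reduce u) v ≡ act u v
act-reduce []      v p = refl
act-reduce (a ∷ u) v p =
  trans (act-push a (reduce u) v p) (cong (push a) (act-reduce u v p))

act-++ : ∀ u u′ v → act (u ++ u′) v ≡ act u (act u′ v)
act-++ u u′ v = foldr-++ push v u u′

reduce-reduced-id : ∀ w → Reduced w → reduce w ≡ w
reduce-reduced-id []      p = refl
reduce-reduced-id (a ∷ w) p =
  trans (cong (push a) (reduce-reduced-id w (reduced-tail′ a w p)))
        (push-fresh a w (reduced-head a w p))

reduce-++-reduced : ∀ u v → Reduced v → reduce (u ++ v) ≡ act u v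
reduce-++-reduced u v p =
  trans (foldr-++ push [] u v) (cong (act u) (reduce-reduced-id v p))

·-word : ∀ x y → proj₁ (x · y) ≡ act (proj₁ x) (proj₁ y)
·-word (u , _) (v , p) = reduce-++-reduced u v p

·-assoc : ∀ x y z → (x · y) · z ≡ x · (y · z)
·-assoc x@(u , _) y@(v , _) z@(w , p) = Δ-ext (begin
  reduce (reduce (u ++ v) ++ w)  ≡⟨ reduce-++-reduced (reduce (u ++ v)) w p ⟩
  act (reduce (u ++ v)) w        ≡⟨ act-reduce (u ++ v) w p ⟩
  act (u ++ v) w           ≡⟨ act-++ u v w ⟩
  act u (act v w)          ≡⟨ cong (act u) (·-word y z) ⟨
  act u (proj₁ (y · z))    ≡⟨ ·-word x (y · z) ⟨
  proj₁ (x · (y · z))      ∎)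
  where open ≡-Reasoning

·-identityˡ : ∀ x → e · x ≡ x
·-identityˡ (u , p) = Δ-ext (reduce-reduced-id u p)

·-identityʳ : ∀ x → x · e ≡ x
·-identityʳ (u , p) = Δ-ext (trans (cong reduce (++-identityʳ u)) (reduce-reduced-id u p))

reduced-ʳ++ : ∀ u v → Reduced u → Reduced v → T (compatible u v) → Reduced (u ʳ++ v)
reduced-ʳ++ []      v _ q _ = q
reduced-ʳ++ (a ∷ u) v p q c =
  reduced-ʳ++ u (a ∷ v) (reduced-tail′ a u p) (reduced-∷ v q c) (compatible-tail u p)
  where
  reduced-∷ : ∀ v → Reduced v → T (compatible (a ∷ u) v) → Reduced (a ∷ v)
  reduced-∷ []      _ _ = tt
  reduced-∷ (b ∷ v) q c with a == b
  ... | false = q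
  compatible-tail : ∀ u → Reduced (a ∷ u) → T (compatible u (a ∷ v))
  compatible-tail []      _ = tt
  compatible-tail (b ∷ u) p =
    subst (λ c → T (not c)) (==-sym a b) (reduced-head a (b ∷ u) p)

reverse-reduced : ∀ w → Reduced w → Reduced (reverse w)
reverse-reduced []      p = tt
reverse-reduced (a ∷ w) p = reduced-ʳ++ (a ∷ w) [] p tt tt

infix 8 _⁻¹

_⁻¹ : Δ → Δ
(w , p) ⁻¹ = reverse w , reverse-reduced w p

act-reverse-cancel : ∀ u v → act (reverse u) (u ++ v) ≡ v
act-reverse-cancel []      v = refl
act-reverse-cancel (a ∷ u) v = begin
  act (reverse (a ∷ u)) (a ∷ u ++ v)      ≡⟨ cong (λ t → act t (a ∷ u ++ v)) (unfold-reverse a u) ⟩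
  act (reverse u ++ a ∷ []) (a ∷ u ++ v)  ≡⟨ act-++ (reverse u) (a ∷ []) (a ∷ u ++ v) ⟩
  act (reverse u) (push a (a ∷ u ++ v))   ≡⟨ cong (act (reverse u)) (push-cancel a (u ++ v)) ⟩
  act (reverse u) (u ++ v)                ≡⟨ act-reverse-cancel u v ⟩
  v                                       ∎
  where open ≡-Reasoning

·-inverseˡ : ∀ x → x ⁻¹ · x ≡ e
·-inverseˡ (u , p) = Δ-ext (begin
  reduce (reverse u ++ u)   ≡⟨ reduce-++-reduced (reverse u) u p ⟩
  act (reverse u) u         ≡⟨ cong (act (reverse u)) (++-identityʳ u) ⟨
  act (reverse u) (u ++ []) ≡⟨ act-reverse-cancel u [] ⟩
  []                        ∎)
  where open ≡-Reasoning

·-inverseʳ : ∀ x → x · x ⁻¹ ≡ e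
·-inverseʳ x = subst (λ y → y · x ⁻¹ ≡ e) (Δ-ext {x ⁻¹ ⁻¹} {x} (reverse-involutive (proj₁ x))) (·-inverseˡ (x ⁻¹))

Δ-group : Group _ _
Δ-group = record
  { Carrier = Δ
  ; _≈_     = _≡_
  ; _∙_     = _·_
  ; ε       = e
  ; _⁻¹     = _⁻¹
  ; isGroup = record
    { isMonoid = record
      { isSemigroup = record
        { isMagma = record { isEquivalence = isEquivalence ; ∙-cong = cong₂ _·_ }
        ; assoc   = ·-assoc
        }
      ; identity = ·-identityˡ , ·-identityʳ
      }
    ; inverse = ·-inverseˡ , ·-inverseʳ
    ; ⁻¹-cong = cong _⁻¹
    }
  }

open GroupProperties Δ-group
open GroupLemmas Δ-group

xnor : Bool → Bool → Bool
xnor a b = if a then b else not b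

parity : Δ → Bool
parity x = evenL (proj₁ x)

parity-· : ∀ x y → parity (x · y) ≡ xnor (parity x) (parity y)
parity-· (u , _) (v , _) = trans (even-reduce (u ++ v)) (even-++ u v)

IsOdd : Δ → Set
IsOdd x = T (not (parity x))

parity-cases : ∀ x → IsEven x ⊎ IsOdd x
parity-cases x with parity x
... | true  = inj₁ tt
... | false = inj₂ tt

even-odd-⊥ : ∀ x → IsEven x → IsOdd x → ⊥
even-odd-⊥ x p q with parity x
even-odd-⊥ x () q | false

odd-·-odd : ∀ x y → IsOdd x → IsOdd y → IsEven (x · y)
odd-·-odd x y p q = subst T (sym (parity-· x y)) (lemma (parity x) (parity y) p q)
  where
  lemma : ∀ a b → T (not a) → T (not b) → T (xnor a b)
  lemma false false _ _ = tt

even-·-odd : ∀ x y → IsEven x → IsOdd y → IsOdd (x · y)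
even-·-odd x y p q = subst (T ∘ not) (sym (parity-· x y)) (lemma (parity x) (parity y) p q)
  where
  lemma : ∀ a b → T a → T (not b) → T (not (xnor a b))
  lemma true false _ _ = tt

odd-·-even : ∀ x y → IsOdd x → IsEven y → IsOdd (x · y)
odd-·-even x y p q = subst (T ∘ not) (sym (parity-· x y)) (lemma (parity x) (parity y) p q)
  where
  lemma : ∀ a b → T (not a) → T b → T (not (xnor a b))
  lemma false true _ _ = tt

evenL-reverse : ∀ w → evenL (reverse w) ≡ evenL w
evenL-reverse []      = refl
evenL-reverse (a ∷ w) = begin
  evenL (reverse (a ∷ w))                                  ≡⟨ cong evenL (unfold-reverse a w) ⟩
  evenL (reverse w ++ a ∷ [])                              ≡⟨ even-++ (reverse w) (a ∷ []) ⟩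
  xnor (evenL (reverse w)) false                           ≡⟨ cong (λ b → xnor b false) (evenL-reverse w) ⟩
  xnor (evenL w) false                                     ≡⟨ xnor-false (evenL w) ⟩
  not (evenL w)                                            ∎
  where
  open ≡-Reasoning
  xnor-false : ∀ b → xnor b false ≡ not b
  xnor-false true  = refl
  xnor-false false = refl

parity-⁻¹ : ∀ x → parity (x ⁻¹) ≡ parity x
parity-⁻¹ (w , _) = evenL-reverse w

even-⁻¹ : ∀ x → IsEven x → IsEven (x ⁻¹)
even-⁻¹ x = subst T (sym (parity-⁻¹ x))

even-conj : ∀ g x → IsEven x → IsEven (conj g x)
even-conj g x p = subst T (sym parity-conj) (lemma (parity g) (parity x) p)
  where
  parity-conj : parity (conj g x) ≡ xnor (xnor (parity g) (parity x)) (parity g)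
  parity-conj = trans (parity-· (g · x) (g ⁻¹))
                      (cong₂ xnor (parity-· g x) (parity-⁻¹ g))
  lemma : ∀ a b → T b → T (xnor (xnor a b) a)
  lemma true  true _ = tt
  lemma false true _ = tt

letter-even : ∀ {u v} → IsEven u → IsEven v → ∀ x → IsEven (letter u v x)
letter-even {u} {v} p q (one , false) = p
letter-even {u} {v} p q (one , true)  = even-⁻¹ u p
letter-even {u} {v} p q (two , false) = q
letter-even {u} {v} p q (two , true)  = even-⁻¹ v q

eval-even : ∀ {u v} → IsEven u → IsEven v → ∀ L → IsEven (eval u v L)
eval-even p q []      = tt
eval-even {u} {v} p q (x ∷ L) = even-· (letter u v x) (eval u v L) (letter-even p q x) (eval-even p q L)

even-length : ∀ w → T (evenL w) → ∃ λ k → length w ≡ k + k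
odd-length  : ∀ w → T (not (evenL w)) → ∃ λ k → length w ≡ suc (k + k)

even-length []      _ = 0 , refl
even-length (a ∷ w) p with odd-length w p
... | k , eq = suc k , cong suc (trans eq (sym (+-suc k k)))

odd-length []      ()
odd-length (a ∷ w) p with even-length w (subst T (not-involutive (evenL w)) p)
... | k , eq = k , cong suc eq

reduced-++ˡ : ∀ p q → Reduced (p ++ q) → Reduced p
reduced-++ˡ []          q _ = tt
reduced-++ˡ (a ∷ [])    q _ = tt
reduced-++ˡ (a ∷ b ∷ p) q r =
  reduced-∷∷ a b p (proj₁ a≠b,r′) (reduced-++ˡ (b ∷ p) q (proj₂ a≠b,r′))
  where a≠b,r′ = reduced-∷∷⁻ a b (p ++ q) r

reduced-++ʳ : ∀ p q → Reduced (p ++ q) → Reduced q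
reduced-++ʳ []      q r = r
reduced-++ʳ (a ∷ p) q r = reduced-++ʳ p q (reduced-tail′ a (p ++ q) r)

reduced-++ : ∀ p q → Reduced p → Reduced q → T (compatible (reverse p) q) → Reduced (p ++ q)
reduced-++ p q rp rq c =
  subst Reduced (trans (ʳ++-defn (reverse p)) (cong (_++ q) (reverse-involutive p)))
    (reduced-ʳ++ (reverse p) q (reverse-reduced p rp) rq c)

·-concat : ∀ p q (rp : Reduced p) (rq : Reduced q) (r : Reduced (p ++ q)) →
           (p , rp) · (q , rq) ≡ (p ++ q , r)
·-concat p q _ _ r = Δ-ext (reduce-reduced-id (p ++ q) r)

-- Its two middle letters coincide.
mirror-not-reduced : ∀ a q → ¬ Reduced (reverse (a ∷ q) ++ a ∷ q)
mirror-not-reduced a q r = ==-false⇒≢ (proj₁ (reduced-∷∷⁻ a a q middle)) refl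
  where
  middle : Reduced (a ∷ a ∷ q)
  middle = reduced-++ʳ (reverse q) (a ∷ a ∷ q)
    (subst Reduced (++-assoc (reverse q) (a ∷ []) (a ∷ q))
      (subst (λ t → Reduced (t ++ a ∷ q)) (unfold-reverse a q) r))

take-length-++ : ∀ (xs ys : Word) → take (length xs) (xs ++ ys) ≡ xs
take-length-++ []       ys = refl
take-length-++ (x ∷ xs) ys = cong (x ∷_) (take-length-++ xs ys)

drop-length-++ : ∀ (xs ys : Word) → drop (length xs) (xs ++ ys) ≡ ys
drop-length-++ []       ys = refl
drop-length-++ (x ∷ xs) ys = drop-length-++ xs ys

take-length-ʳ++ : ∀ (xs ys : Word) → take (length xs) (xs ʳ++ ys) ≡ reverse xs
take-length-ʳ++ xs ys = begin
  take (length xs) (xs ʳ++ ys)                 ≡⟨ cong (take (length xs)) (ʳ++-defn xs) ⟩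
  take (length xs) (reverse xs ++ ys)          ≡⟨ cong (λ n → take n (reverse xs ++ ys)) (length-reverse xs) ⟨
  take (length (reverse xs)) (reverse xs ++ ys) ≡⟨ take-length-++ (reverse xs) ys ⟩
  reverse xs                                   ∎
  where open ≡-Reasoning

reverse-drop-reverse : ∀ c (y : Word) → c ≤ length y →
                       reverse (drop c (reverse y)) ≡ take (length y ∸ c) y
reverse-drop-reverse c y c≤∣y∣ = begin
  reverse (drop c (reverse y))
    ≡⟨ cong (λ t → reverse (drop c (reverse t))) (take++drop≡id m y) ⟨
  reverse (drop c (reverse (t ++ d)))                        ≡⟨ cong (λ t′ → reverse (drop c t′)) (reverse-++ t d) ⟩
  reverse (drop c (reverse d ++ reverse t))
    ≡⟨ cong (λ n → reverse (drop n (reverse d ++ reverse t))) ∣d∣≡c ⟨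
  reverse (drop (length (reverse d)) (reverse d ++ reverse t)) ≡⟨ cong reverse (drop-length-++ (reverse d) (reverse t)) ⟩
  reverse (reverse t)                                        ≡⟨ reverse-involutive t ⟩
  t                                                          ∎
  where
  open ≡-Reasoning
  m = length y ∸ c
  t = take m y
  d = drop m y
  ∣d∣≡c : length (reverse d) ≡ c
  ∣d∣≡c = trans (length-reverse d) (trans (length-drop m y) (m∸[m∸n]≡n c≤∣y∣))

lcp : Word → Word → ℕ
lcp (a ∷ x) (b ∷ y) = if a == b then suc (lcp x y) else 0
lcp _       _       = 0

lcp-≤ˡ : ∀ x y → lcp x y ≤ length x
lcp-≤ˡ []      y       = z≤n
lcp-≤ˡ (a ∷ x) []      = z≤n
lcp-≤ˡ (a ∷ x) (b ∷ y) with a == b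
... | true  = s≤s (lcp-≤ˡ x y)
... | false = z≤n

lcp-≤ʳ : ∀ x y → lcp x y ≤ length y
lcp-≤ʳ []      y       = z≤n
lcp-≤ʳ (a ∷ x) []      = z≤n
lcp-≤ʳ (a ∷ x) (b ∷ y) with a == b
... | true  = s≤s (lcp-≤ʳ x y)
... | false = z≤n

lcp-take : ∀ k x y → k ≤ lcp x y → take k x ≡ take k y
lcp-take zero    x       y       _ = refl
lcp-take (suc k) (a ∷ x) (b ∷ y) k<lcp with a == b in eq
... | true = cong₂ _∷_ (==⇒≡ eq) (lcp-take k x y (≤-pred k<lcp))

lcp-take-congʳ : ∀ m x y y′ → lcp x y < m → take m y ≡ take m y′ → lcp x y′ ≡ lcp x y
lcp-take-congʳ m       []      y       y′        _     _  = refl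
lcp-take-congʳ m       (a ∷ x) []      []        _     _  = refl
lcp-take-congʳ (suc m) (a ∷ x) []      (b′ ∷ y′) _     ()
lcp-take-congʳ (suc m) (a ∷ x) (b ∷ y) []        _     ()
lcp-take-congʳ (suc m) (a ∷ x) (b ∷ y) (b′ ∷ y′) lcp<m eq with ∷-injective eq
... | refl , eq′ with a == b
...   | true  = cong suc (lcp-take-congʳ m x y y′ (≤-pred lcp<m) eq′)
...   | false = refl

pushAll : Word → Word → Word
pushAll []      q = q
pushAll (a ∷ p) q = pushAll p (push a q)

act-reverse : ∀ p q → act (reverse p) q ≡ pushAll p q
act-reverse []      q = refl
act-reverse (a ∷ p) q =
  trans (cong (λ t → act t q) (unfold-reverse a p))
        (trans (act-++ (reverse p) (a ∷ []) q) (act-reverse p (push a q)))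

compatible-∷ : ∀ a p q → Reduced (a ∷ p) → T (compatible p (a ∷ q))
compatible-∷ a []      q _ = tt
compatible-∷ a (b ∷ p) q r = subst (λ c → T (not c)) (==-sym a b) (reduced-head a (b ∷ p) r)

pushAll-compatible : ∀ p q → Reduced p → T (compatible p q) → pushAll p q ≡ p ʳ++ q
pushAll-compatible []      q _ _ = refl
pushAll-compatible (a ∷ p) q r c =
  trans (cong (pushAll p) (push-fresh a q (compatible-[] q c)))
        (pushAll-compatible p (a ∷ q) (reduced-tail′ a p r) (compatible-∷ a p q r))
  where
  compatible-[] : ∀ q → T (compatible (a ∷ p) q) → T (compatible (a ∷ []) q)
  compatible-[] []      _ = tt
  compatible-[] (b ∷ q) c = c

pushAll-lcp : ∀ p q → Reduced p → Reduced q →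
              pushAll p q ≡ drop (lcp p q) p ʳ++ drop (lcp p q) q
pushAll-lcp []      q       _ _ = refl
pushAll-lcp (a ∷ p) []      r _ = pushAll-compatible (a ∷ p) [] r tt
pushAll-lcp (a ∷ p) (b ∷ q) r r′ with a == b in eq
... | true  = pushAll-lcp p q (reduced-tail′ a p r) (reduced-tail′ b q r′)
... | false = pushAll-compatible p (a ∷ b ∷ q) (reduced-tail′ a p r) (compatible-∷ a p (b ∷ q) r)

cancellation : Δ → Δ → ℕ
cancellation (p , _) (q , _) = lcp (reverse p) q

·-cancellation : ∀ x y → let c = cancellation x y in
                 proj₁ (x · y) ≡ drop c (reverse (proj₁ x)) ʳ++ drop c (proj₁ y)
·-cancellation x@(p , rp) y@(q , rq) = begin
  proj₁ (x · y)              ≡⟨ ·-word x y ⟩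
  act p q                    ≡⟨ cong (λ t → act t q) (reverse-involutive p) ⟨
  act (reverse (reverse p)) q ≡⟨ act-reverse (reverse p) q ⟩
  pushAll (reverse p) q      ≡⟨ pushAll-lcp (reverse p) q (reverse-reduced p rp) rq ⟩
  _                          ∎
  where open ≡-Reasoning

len : Δ → ℕ
len x = length (proj₁ x)

len-⁻¹ : ∀ x → len (x ⁻¹) ≡ len x
len-⁻¹ (w , _) = length-reverse w

len-· : ∀ x y → len (x · y) ≡ (len x ∸ cancellation x y) + (len y ∸ cancellation x y)
len-· x y = begin
  len (x · y)                                             ≡⟨ cong length (·-cancellation x y) ⟩
  length (drop c (reverse (proj₁ x)) ʳ++ drop c (proj₁ y)) ≡⟨ length-ʳ++ (drop c (reverse (proj₁ x))) ⟩
  length (drop c (reverse (proj₁ x))) + length (drop c (proj₁ y))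
    ≡⟨ cong₂ _+_ (trans (length-drop c (reverse (proj₁ x))) (cong (_∸ c) (length-reverse (proj₁ x))))
                 (length-drop c (proj₁ y)) ⟩
  (len x ∸ c) + (len y ∸ c)                               ∎
  where
  open ≡-Reasoning
  c = cancellation x y

cancellation-≤ˡ : ∀ x y → cancellation x y ≤ len x
cancellation-≤ˡ (p , _) (q , _) = subst (lcp (reverse p) q ≤_) (length-reverse p) (lcp-≤ˡ (reverse p) q)

cancellation-≤ʳ : ∀ x y → cancellation x y ≤ len y
cancellation-≤ʳ (p , _) (q , _) = lcp-≤ʳ (reverse p) q

length-drop-half : ∀ (y : Word) k → length y ≡ k + k → length (drop k y) ≡ k
length-drop-half y k ∣y∣≡2k = trans (length-drop k y) (trans (cong (_∸ k) ∣y∣≡2k) (m+n∸m≡n k k))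

take-half-reverse : ∀ (y : Word) k → length y ≡ k + k → take k (reverse y) ≡ reverse (drop k y)
take-half-reverse y k ∣y∣≡2k = begin
  take k (reverse y)                                  ≡⟨ cong (λ t → take k (reverse t)) (take++drop≡id k y) ⟨
  take k (reverse (p ++ q))                           ≡⟨ cong (take k) (reverse-++ p q) ⟩
  take k (reverse q ++ reverse p)                     ≡⟨ cong (λ n → take n (reverse q ++ reverse p)) ∣q∣≡k ⟨
  take (length (reverse q)) (reverse q ++ reverse p)  ≡⟨ take-length-++ (reverse q) (reverse p) ⟩
  reverse q                                           ∎
  where
  open ≡-Reasoning
  p = take k y
  q = drop k y
  ∣q∣≡k : length (reverse q) ≡ k
  ∣q∣≡k = trans (length-reverse q) (length-drop-half y k ∣y∣≡2k)

first-half-not-mirror : ∀ y k → Reduced y → length y ≡ k + k → 0 < k →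
                        ¬ take k y ≡ take k (reverse y)
first-half-not-mirror y k r ∣y∣≡2k 0<k mirror with drop k y in q-def
... | []    = n≮n 0 (subst (0 <_) (trans (sym (length-drop-half y k ∣y∣≡2k)) (cong length q-def)) 0<k)
... | a ∷ q = mirror-not-reduced a q (subst Reduced y≡mirror r)
  where
  y≡mirror : y ≡ reverse (a ∷ q) ++ a ∷ q
  y≡mirror = begin
    y                            ≡⟨ take++drop≡id k y ⟨
    take k y ++ drop k y         ≡⟨ cong₂ _++_ (trans mirror (take-half-reverse y k ∣y∣≡2k)) q-def ⟩
    reverse (drop k y) ++ a ∷ q  ≡⟨ cong (λ t → reverse t ++ a ∷ q) q-def ⟩
    reverse (a ∷ q) ++ a ∷ q     ∎
    where open ≡-Reasoning

-- Restriction to Δ⁺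

empty-word : ∀ (x : Δ) → len x ≡ 0 → x ≡ e
empty-word ([] , _) _ = refl

involution-odd : ∀ x → x · x ≡ e → ¬ x ≡ e → IsOdd x
involution-odd x x²≡e x≢e with parity x in even
... | false = tt
... | true with even-length (proj₁ x) (subst T (sym even) tt)
...   | zero  , ∣x∣≡0  = x≢e (empty-word x ∣x∣≡0)
...   | suc k , ∣x∣≡2k = first-half-not-mirror (proj₁ x) (suc k) (proj₂ x) ∣x∣≡2k (s≤s z≤n)
                           (cong (take (suc k) ∘ proj₁) x≡x⁻¹)
  where
  x≡x⁻¹ : x ≡ x ⁻¹
  x≡x⁻¹ = inverseʳ-unique x x x²≡e


r-involution : ∀ i → r i · r i ≡ e
r-involution i = Δ-ext (push-cancel i [])

r≢e : ∀ i → ¬ r i ≡ e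
r≢e i ()

Δ⁺-ext : ∀ {x y : Δ⁺} → proj₁ x ≡ proj₁ y → x ≡ y
Δ⁺-ext {x , p} {.x , q} refl = cong (x ,_) (T-irrelevant p q)

module _ (α : AutΔ) where

  fun-e : fun α e ≡ e
  fun-e = identityʳ-unique (fun α e) (fun α e) (trans (sym (hom α e e)) (cong (fun α) (·-identityˡ e)))

  fun-injective : ∀ {x y} → fun α x ≡ fun α y → x ≡ y
  fun-injective {x} {y} eq = trans (sym (linv α x)) (trans (cong (inv α) eq) (linv α y))

  fun-r-involution : ∀ i → fun α (r i) · fun α (r i) ≡ e
  fun-r-involution i = trans (sym (hom α (r i) (r i))) (trans (cong (fun α) (r-involution i)) fun-e)

  fun-r-odd : ∀ i → IsOdd (fun α (r i))
  fun-r-odd i = involution-odd (fun α (r i)) (fun-r-involution i)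
    (λ eq → r≢e i (fun-injective (trans eq (sym fun-e))))

  parity-fun : ∀ x → parity (fun α x) ≡ parity x
  parity-fun (w , p) = parity-fun-word w p
    where
    odd≡false : ∀ {b} → T (not b) → b ≡ false
    odd≡false {false} _ = refl
    parity-fun-word : ∀ w (p : Reduced w) → parity (fun α (w , p)) ≡ evenL w
    parity-fun-word []      tt = cong parity fun-e
    parity-fun-word (i ∷ w) p  = begin
      parity (fun α (i ∷ w , p))                                ≡⟨ cong (parity ∘ fun α) (·-concat (i ∷ []) w tt p′ p) ⟨
      parity (fun α (r i · (w , p′)))                           ≡⟨ cong parity (hom α (r i) (w , p′)) ⟩
      parity (fun α (r i) · fun α (w , p′))                     ≡⟨ parity-· (fun α (r i)) (fun α (w , p′)) ⟩
      xnor (parity (fun α (r i))) (parity (fun α (w , p′)))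
        ≡⟨ cong₂ xnor (odd≡false (fun-r-odd i)) (parity-fun-word w p′) ⟩
      not (evenL w)                                             ∎
      where
      open ≡-Reasoning
      p′ = reduced-tail′ i w p

  parity-inv : ∀ x → parity (inv α x) ≡ parity x
  parity-inv x = trans (sym (parity-fun (inv α x))) (cong parity (rinv α x))

  restriction : AutΔ⁺
  restriction = record
    { fun  = λ (x , p) → fun α x , subst T (sym (parity-fun x)) p
    ; inv  = λ (x , p) → inv α x , subst T (sym (parity-inv x)) p
    ; hom  = λ (x , _) (y , _) → Δ⁺-ext (hom α x y)
    ; linv = λ (x , _) → Δ⁺-ext (linv α x)
    ; rinv = λ (x , _) → Δ⁺-ext (rinv α x)
    }

  restriction-restricts : Restricts α restriction
  restriction-restricts x p = refl

restricts-∘ : ∀ α α′ β β′ → Restricts α β → Restricts α′ β′ → Restricts (α ∘ᴬ α′) (β ∘ᴬ β′)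
restricts-∘ α α′ β β′ α|β α′|β′ x p =
  trans (α|β (proj₁ (fun β′ (x , p))) (proj₂ (fun β′ (x , p)))) (cong (fun α) (α′|β′ x p))

-- Injectivity of the restriction

-- For t = a ⋯ b ≠ e choose i ∉ {a, b} and j ∉ {a, i}: then t · rᵢrⱼ and rᵢrⱼ · t are
-- both reduced concatenations, beginning with a and with i respectively.
centralises-Δ⁺⇒≡e : ∀ t → (∀ i j → ¬ i ≡ j → t · (r i · r j) ≡ (r i · r j) · t) → t ≡ e
centralises-Δ⁺⇒≡e ([] , tt) _ = refl
centralises-Δ⁺⇒≡e t@(a ∷ w , rt) central with reverse (a ∷ w) in rev-t
... | [] = ⊥-elim (1+n≢0 (trans (sym (length-reverse (a ∷ w))) (cong length rev-t)))
... | b ∷ _ with third-letter a b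
...   | i , i≢a , i≢b with third-letter a i
...     | j , j≢a , j≢i = ⊥-elim (i≢a (sym (proj₁ (∷-injective heads))))
  where
  i≢j : ¬ i ≡ j
  i≢j = j≢i ∘ sym
  rij : Reduced (i ∷ j ∷ [])
  rij = reduced-∷∷ i j [] (≢⇒==-false i≢j) tt
  rij≡ : r i · r j ≡ (i ∷ j ∷ [] , rij)
  rij≡ = ·-concat (i ∷ []) (j ∷ []) tt tt rij
  b≁i : T (compatible (reverse (a ∷ w)) (i ∷ j ∷ []))
  b≁i = subst (λ u → T (compatible u (i ∷ j ∷ []))) (sym rev-t)
          (subst (T ∘ not) (sym (≢⇒==-false (i≢b ∘ sym))) tt)
  right : t · (r i · r j) ≡ (a ∷ w ++ i ∷ j ∷ [] , _)
  right = trans (cong (t ·_) rij≡)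
    (·-concat (a ∷ w) (i ∷ j ∷ []) rt rij (reduced-++ (a ∷ w) (i ∷ j ∷ []) rt rij b≁i))
  left : (r i · r j) · t ≡ (i ∷ j ∷ a ∷ w , _)
  left = trans (cong (_· t) rij≡) (·-concat (i ∷ j ∷ []) (a ∷ w) rij rt
    (reduced-∷∷ i j (a ∷ w) (≢⇒==-false i≢j) (reduced-∷∷ j a w (≢⇒==-false j≢a) rt)))
  heads : a ∷ w ++ i ∷ j ∷ [] ≡ i ∷ j ∷ a ∷ w
  heads = cong proj₁ (trans (sym right) (trans (central i j i≢j) left))

r₀ : Δ
r₀ = r zero

module _ (α α′ : AutΔ) (β : AutΔ⁺) (α|β : Restricts α β) (α′|β : Restricts α′ β) where

  private
    s s′ : Δ
    s  = fun α r₀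
    s′ = fun α′ r₀

  agree-even : ∀ x → IsEven x → fun α x ≡ fun α′ x
  agree-even x p = trans (sym (α|β x p)) (α′|β x p)

  conj-agree : ∀ y → IsEven y → s · y · s ≡ s′ · y · s′
  conj-agree y p = begin
    s · y · s                  ≡⟨ cong (λ t → s · t · s) (rinv α y) ⟨
    s · fun α x · s            ≡⟨ cong (_· s) (hom α r₀ x) ⟨
    fun α (r₀ · x) · s         ≡⟨ hom α (r₀ · x) r₀ ⟨
    fun α (r₀ · x · r₀)        ≡⟨ agree-even (r₀ · x · r₀) r₀xr₀-even ⟩
    fun α′ (r₀ · x · r₀)       ≡⟨ hom α′ (r₀ · x) r₀ ⟩
    fun α′ (r₀ · x) · s′       ≡⟨ cong (_· s′) (hom α′ r₀ x) ⟩
    s′ · fun α′ x · s′         ≡⟨ cong (λ t → s′ · t · s′) (agree-even x x-even) ⟨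
    s′ · fun α x · s′          ≡⟨ cong (λ t → s′ · t · s′) (rinv α y) ⟩
    s′ · y · s′                ∎
    where
    open ≡-Reasoning
    x = inv α y
    x-even : IsEven x
    x-even = subst T (sym (parity-inv α y)) p
    r₀xr₀-even : IsEven (r₀ · x · r₀)
    r₀xr₀-even = odd-·-odd (r₀ · x) r₀ (odd-·-even r₀ x tt x-even) tt

  s≡s′ : s ≡ s′
  s≡s′ = trans (inverseʳ-unique s′ s s′s≡e) (involution-⁻¹ (fun-r-involution α′ zero))
    where
    s′s≡e : s′ · s ≡ e
    s′s≡e = centralises-Δ⁺⇒≡e (s′ · s) λ i j _ →
      conj-agree⇒commute {s} {s′} {r i · r j} (fun-r-involution α zero) (fun-r-involution α′ zero)
        (conj-agree (r i · r j) (subst T (sym (parity-· (r i) (r j))) tt))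

  restriction-injective : ∀ x → fun α x ≡ fun α′ x
  restriction-injective x with parity-cases x
  ... | inj₁ even = agree-even x even
  ... | inj₂ odd  = begin
    fun α x                 ≡⟨ cong (fun α) x≡xr₀r₀ ⟩
    fun α (x · r₀ · r₀)     ≡⟨ hom α (x · r₀) r₀ ⟩
    fun α (x · r₀) · s      ≡⟨ cong₂ _·_ (agree-even (x · r₀) (odd-·-odd x r₀ odd tt)) s≡s′ ⟩
    fun α′ (x · r₀) · s′    ≡⟨ hom α′ (x · r₀) r₀ ⟨
    fun α′ (x · r₀ · r₀)    ≡⟨ cong (fun α′) x≡xr₀r₀ ⟨
    fun α′ x                ∎
    where
    open ≡-Reasoning
    x≡xr₀r₀ : x ≡ x · r₀ · r₀
    x≡xr₀r₀ = sym (trans (·-assoc x r₀ r₀) (trans (cong (x ·_) (r-involution zero)) (·-identityʳ x)))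

-- Nielsen reduction of generating pairs of Δ⁺

Generates : Δ → Δ → Set
Generates u v = ∀ x → IsEven x → InSpan u v x

record GeneratingPair (u v : Δ) : Set where
  field
    even₁     : IsEven u
    even₂     : IsEven v
    generates : Generates u v

open GeneratingPair

GeneratingPair-swap : ∀ {u v} → GeneratingPair u v → GeneratingPair v u
GeneratingPair-swap G = record
  { even₁ = even₂ G
  ; even₂ = even₁ G
  ; generates = λ x p → span-⊆ (span-letter (two , false)) (span-letter (one , false)) (generates G x p)
  }

GeneratingPair-⁻¹ : ∀ {u v} → GeneratingPair u v → GeneratingPair (u ⁻¹) v
GeneratingPair-⁻¹ {u} G = record
  { even₁ = even-⁻¹ u (even₁ G)
  ; even₂ = even₂ G
  ; generates = λ x p → span-⊆ (span-resp (⁻¹-involutive u) (span-letter (one , true)))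
                               (span-letter (two , false)) (generates G x p)
  }

GeneratingPair-∙ : ∀ {u v} → GeneratingPair u v → GeneratingPair (u · v) v
GeneratingPair-∙ {u} {v} G = record
  { even₁ = even-· u v (even₁ G) (even₂ G)
  ; even₂ = even₂ G
  ; generates = λ x p → span-⊆
      (span-resp (//-rightDividesʳ v u) (span-∙ (span-letter (one , false)) (span-letter (two , true))))
      (span-letter (two , false)) (generates G x p)
  }

GeneratingPair-∙ʳ : ∀ {u v} → GeneratingPair u v → GeneratingPair u (u · v)
GeneratingPair-∙ʳ {u} {v} G = record
  { even₁ = even₁ G
  ; even₂ = even-· u v (even₁ G) (even₂ G)
  ; generates = λ x p → span-⊆ (span-letter (one , false))
      (span-resp (\\-leftDividesʳ u v) (span-∙ (span-letter (one , true)) (span-letter (two , false))))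
      (generates G x p)
  }

GeneratingPair-conj : ∀ {u v} g → GeneratingPair u v → GeneratingPair (conj g u) (conj g v)
GeneratingPair-conj {u} {v} g G = record
  { even₁ = even-conj g u (even₁ G)
  ; even₂ = even-conj g v (even₂ G)
  ; generates = λ x p → span-resp (conj-conj-⁻¹ g x)
      (span-conj g (generates G (conj (g ⁻¹) x) (even-conj (g ⁻¹) x p)))
  }

record Reduction (u v : Δ) : Set where
  field
    {u′ v′}  : Δ
    shorter : len u′ + len v′ < len u + len v
    pair    : GeneratingPair u′ v′
    reflect : JointlyInverted u′ v′ → JointlyInverted u v

open Reduction

Reduction-swap : ∀ {u v} → Reduction u v → Reduction v u
Reduction-swap {u} {v} R = record
  { shorter = subst (len (u′ R) + len (v′ R) <_) (+-comm (len u) (len v)) (shorter R)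
  ; pair    = pair R
  ; reflect = JointlyInverted-swap ∘ reflect R
  }

Reduction-⁻¹ : ∀ {u v} → Reduction u v → Reduction (u ⁻¹) v
Reduction-⁻¹ {u} {v} R = record
  { shorter = subst (λ n → len (u′ R) + len (v′ R) < n + len v) (sym (len-⁻¹ u)) (shorter R)
  ; pair    = pair R
  ; reflect = JointlyInverted-⁻¹ ∘ reflect R
  }

-- Two letters from different generators form the pair up to order and inversions.
module LetterPairs {P : Δ → Δ → Set}
                   (P-swap : ∀ {u v} → P u v → P v u)
                   (P-⁻¹   : ∀ {u v} → P u v → P (u ⁻¹) v) where

  private
    P-signedˡ : ∀ b {u v} → P u v → P (signed b u) v
    P-signedˡ false p = p
    P-signedˡ true  p = P-⁻¹ p

    P-signed : ∀ b c {u v} → P u v → P (signed b u) (signed c v)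
    P-signed b c p = P-signedˡ b (P-swap (P-signedˡ c (P-swap p)))

    signed-signed : ∀ b x → signed b (signed b x) ≡ x
    signed-signed false x = refl
    signed-signed true  x = ⁻¹-involutive x

    unsign : ∀ b c {u v} → P (signed b (signed b u)) (signed c (signed c v)) → P u v
    unsign b c {u} {v} = subst₂ P (signed-signed b u) (signed-signed c v)

  letter-pair : ∀ {u v} x y → ¬ proj₁ x ≡ proj₁ y → P u v → P (letter u v x) (letter u v y)
  letter-pair (one , b) (one , c) ≢ = ⊥-elim (≢ refl)
  letter-pair (one , b) (two , c) _ = P-signed b c
  letter-pair (two , b) (one , c) _ = P-signed b c ∘ P-swap
  letter-pair (two , b) (two , c) ≢ = ⊥-elim (≢ refl)

  letter-pair⁻ : ∀ {u v} x y → ¬ proj₁ x ≡ proj₁ y → P (letter u v x) (letter u v y) → P u v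
  letter-pair⁻ (one , b) (one , c) ≢ = ⊥-elim (≢ refl)
  letter-pair⁻ (one , b) (two , c) _ = unsign b c ∘ P-signed b c
  letter-pair⁻ (two , b) (one , c) _ = P-swap ∘ unsign b c ∘ P-signed b c
  letter-pair⁻ (two , b) (two , c) ≢ = ⊥-elim (≢ refl)

∸+∸-≥ˡ : ∀ a b c → c + c ≤ a → c + c ≤ b → a ≤ (a ∸ c) + (b ∸ c)
∸+∸-≥ˡ a b c 2c≤a 2c≤b = begin
  a              ≡⟨ m∸n+n≡m (m+n≤o⇒m≤o c 2c≤a) ⟨
  a ∸ c + c       ≤⟨ +-monoʳ-≤ (a ∸ c) (m+n≤o⇒m≤o∸n c 2c≤b) ⟩
  a ∸ c + (b ∸ c) ∎
  where open ≤-Reasoning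

∸+∸-≥ʳ : ∀ a b c → c + c ≤ a → c + c ≤ b → b ≤ (a ∸ c) + (b ∸ c)
∸+∸-≥ʳ a b c 2c≤a 2c≤b = subst (b ≤_) (+-comm (b ∸ c) (a ∸ c)) (∸+∸-≥ˡ b a c 2c≤b 2c≤a)

∸+∸-<ˡ : ∀ a b c → c ≤ a → b < c + c → (a ∸ c) + (b ∸ c) < a
∸+∸-<ˡ a b zero    _   ()
∸+∸-<ˡ a b (suc c) c≤a b<2c = begin-strict
  a ∸ suc c + (b ∸ suc c) <⟨ +-monoʳ-< (a ∸ suc c) (m<n+o⇒m∸n<o b (suc c) b<2c) ⟩
  a ∸ suc c + suc c       ≡⟨ m∸n+n≡m c≤a ⟩
  a                       ∎
  where open ≤-Reasoning

∸+∸-<ʳ : ∀ a b c → c ≤ b → a < c + c → (a ∸ c) + (b ∸ c) < b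
∸+∸-<ʳ a b c c≤b a<2c = subst (_< b) (+-comm (b ∸ c) (a ∸ c)) (∸+∸-<ˡ b a c c≤b a<2c)

-- Nielsen's conditions on the letters u^{±1}, v^{±1}: in every product of two letters at
-- most half of each letter cancels, and in every product of three letters part of the
-- middle one survives.
module NielsenConditions (u v : Δ) where

  g : Symbol → Δ
  g = letter u v

  c : Symbol → Symbol → ℕ
  c x y = cancellation (g x) (g y)

  CancelsAtMostHalf : Set
  CancelsAtMostHalf = ∀ x y → ¬ y ≡ x ⁻ → c x y + c x y ≤ len (g x) × c x y + c x y ≤ len (g y)

  MiddleSurvives : Set
  MiddleSurvives = ∀ x y z → ¬ y ≡ x ⁻ → ¬ z ≡ y ⁻ → c x y + c y z < len (g y)

  module _ (half : CancelsAtMostHalf) (middle : MiddleSurvives) where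

    -- Induction on the word: since part of every letter survives, the cancellation between a
    -- letter and the value of the word that follows it stays inside that word's first letter.
    reduced-word-lengths : ∀ y L → FreelyReduced (y ∷ L) →
      (∀ x → ¬ y ≡ x ⁻ → cancellation (g x) (eval u v (y ∷ L)) ≡ c x y)
      × All (λ z → len (g z) ≤ len (eval u v (y ∷ L))) (y ∷ L)
    reduced-word-lengths y [] _ =
        (λ x _ → cong (cancellation (g x)) (·-identityʳ (g y)))
      , ≤-reflexive (cong len (sym (·-identityʳ (g y)))) ∷ []
    reduced-word-lengths y (z ∷ L) (z≢y⁻ , reduced) =
      cancel-y , (∣y∣≤∣w∣ ∷ All.map (λ le → ≤-trans le ∣w′∣≤∣w∣) (proj₂ IH))
      where
      IH = reduced-word-lengths z L reduced
      w′ = eval u v (z ∷ L)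
      w  = g y · w′
      k  = cancellation (g y) w′
      k≡ : k ≡ c y z
      k≡ = proj₁ IH y z≢y⁻
      2k≤∣y∣ : k + k ≤ len (g y)
      2k≤∣y∣ = subst (λ t → t + t ≤ len (g y)) (sym k≡) (proj₁ (half y z z≢y⁻))
      2k≤∣w′∣ : k + k ≤ len w′
      2k≤∣w′∣ = ≤-trans (subst (λ t → t + t ≤ len (g z)) (sym k≡) (proj₂ (half y z z≢y⁻))) (All.head (proj₂ IH))
      ∣w∣≡ : len w ≡ (len (g y) ∸ k) + (len w′ ∸ k)
      ∣w∣≡ = len-· (g y) w′
      ∣w′∣≤∣w∣ : len w′ ≤ len w
      ∣w′∣≤∣w∣ = subst (len w′ ≤_) (sym ∣w∣≡) (∸+∸-≥ʳ (len (g y)) (len w′) k 2k≤∣y∣ 2k≤∣w′∣)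
      ∣y∣≤∣w∣ : len (g y) ≤ len w
      ∣y∣≤∣w∣ = subst (len (g y) ≤_) (sym ∣w∣≡) (∸+∸-≥ˡ (len (g y)) (len w′) k 2k≤∣y∣ 2k≤∣w′∣)
      m = len (g y) ∸ k
      prefix : take m (proj₁ w) ≡ take m (proj₁ (g y))
      prefix = begin
        take m (proj₁ w)                         ≡⟨ cong (take m) (·-cancellation (g y) w′) ⟩
        take m (X ʳ++ drop k (proj₁ w′))          ≡⟨ cong (λ n → take n (X ʳ++ drop k (proj₁ w′))) ∣X∣≡m ⟨
        take (length X) (X ʳ++ drop k (proj₁ w′)) ≡⟨ take-length-ʳ++ X (drop k (proj₁ w′)) ⟩
        reverse X                                ≡⟨ reverse-drop-reverse k (proj₁ (g y)) (m+n≤o⇒m≤o k 2k≤∣y∣) ⟩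
        take m (proj₁ (g y))                     ∎
        where
        open ≡-Reasoning
        X = drop k (reverse (proj₁ (g y)))
        ∣X∣≡m : length X ≡ m
        ∣X∣≡m = trans (length-drop k (reverse (proj₁ (g y)))) (cong (_∸ k) (length-reverse (proj₁ (g y))))
      cancel-y : ∀ x → ¬ y ≡ x ⁻ → cancellation (g x) w ≡ c x y
      cancel-y x y≢x⁻ = lcp-take-congʳ m (reverse (proj₁ (g x))) (proj₁ (g y)) (proj₁ w) c<m (sym prefix)
        where
        c<m : c x y < m
        c<m = m+n≤o⇒m≤o∸n (suc (c x y)) (subst (λ t → c x y + t < len (g y)) (sym k≡) (middle x y z y≢x⁻ z≢y⁻))

    short-letters : ∀ {x} → InSpan u v x → ¬ x ≡ e →
                    ∃ λ L → All (λ z → len (g z) ≤ len x) L × eval u v L ≡ x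
    short-letters x∈ x≢e with freely-reduced-word x∈
    ... | []    , _       , eq = ⊥-elim (x≢e (sym eq))
    ... | y ∷ L , reduced , eq =
      y ∷ L , All.map (subst (_ ≤_) (cong len eq)) (proj₂ (reduced-word-lengths y L reduced)) , eq

ρ₂ρ₀≢ρ₀ρ₂ : ¬ ρ₂ · ρ₀ ≡ ρ₀ · ρ₂
ρ₂ρ₀≢ρ₀ρ₂ ()

ρ₂≢e : ¬ ρ₂ ≡ e
ρ₂≢e ()

ρ₀≢e : ¬ ρ₀ ≡ e
ρ₀≢e ()

commuting-words-⊥ : ∀ {u v} {P : Symbol → Set} →
                    (∀ {x y} → P x → P y → Commute (letter u v x) (letter u v y)) →
                    (∃ λ L → All P L × eval u v L ≡ ρ₂) → (∃ λ L → All P L × eval u v L ≡ ρ₀) → ⊥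
commuting-words-⊥ {u} {v} commute (L₂ , P₂ , eq₂) (L₀ , P₀ , eq₀) = ρ₂ρ₀≢ρ₀ρ₂ (begin
  ρ₂ · ρ₀                      ≡⟨ cong₂ _·_ eq₂ eq₀ ⟨
  eval u v L₂ · eval u v L₀    ≡⟨ eval-commute commute P₂ P₀ ⟩
  eval u v L₀ · eval u v L₂    ≡⟨ cong₂ _·_ eq₀ eq₂ ⟩
  ρ₀ · ρ₂                      ∎)
  where open ≡-Reasoning

commuting-pair-⊥ : ∀ {u v} → Commute u v → ¬ Generates u v
commuting-pair-⊥ {u} {v} uv≡vu gen =
  commuting-words-⊥ {P = λ _ → ⊤} (λ {x} {y} _ _ → letters-commute x y) (word ρ₂ tt) (word ρ₀ tt)
  where
  generators-commute : ∀ i j → Commute (generator u v i) (generator u v j)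
  generators-commute one one = refl
  generators-commute one two = uv≡vu
  generators-commute two one = sym uv≡vu
  generators-commute two two = refl
  letters-commute : ∀ x y → Commute (letter u v x) (letter u v y)
  letters-commute (i , b) (j , c) = commute-signed b c (generators-commute i j)
  word : ∀ x → IsEven x → ∃ λ L → All (λ _ → ⊤) L × eval u v L ≡ x
  word x p with gen x p
  ... | L , eq = L , All.universal (λ _ → tt) L , eq

module _ {u v : Δ} (gen : Generates u v) where
  open NielsenConditions u v

  -- Under Nielsen's conditions ρ₂ and ρ₀, of length 2, are words in letters of length at most 2;
  -- if these are all powers of one generator, ρ₂ and ρ₀ would commute.
  nielsen-conditions-fail : ∀ w → (∀ z → len (g z) ≤ 2 → proj₁ z ≡ w) →
                            CancelsAtMostHalf → MiddleSurvives → ⊥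
  nielsen-conditions-fail w short⇒w half middle =
    commuting-words-⊥ (λ {x} {y} → same-generator-commute x y) (word ρ₂ ρ₂≢e refl) (word ρ₀ ρ₀≢e refl)
    where
    same-generator-commute : ∀ x y → proj₁ x ≡ w → proj₁ y ≡ w → Commute (g x) (g y)
    same-generator-commute (_ , b) (_ , c) refl refl =
      commute-signed {generator u v w} {generator u v w} b c refl
    word : ∀ x → ¬ x ≡ e → len x ≡ 2 → {IsEven x} → ∃ λ L → All (λ z → proj₁ z ≡ w) L × eval u v L ≡ x
    word x x≢e ∣x∣≡2 {p} with short-letters half middle (gen x p) x≢e
    ... | L , short , eq = L , All.map (λ {z} ≤∣x∣ → short⇒w z (subst (_ ≤_) ∣x∣≡2 ≤∣x∣)) short , eq

len-·-≤ : ∀ x y → len (x · y) ≤ len x + len y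
len-·-≤ x y = subst (_≤ len x + len y) (sym (len-· x y))
  (+-mono-≤ (m∸n≤m (len x) (cancellation x y)) (m∸n≤m (len y) (cancellation x y)))

half-length : ∀ x → IsEven x → ¬ x ≡ e → ∃ λ k → len x ≡ k + k × 0 < k
half-length x p x≢e with even-length (proj₁ x) p
... | zero  , ∣x∣≡0 = ⊥-elim (x≢e (empty-word x ∣x∣≡0))
... | suc k , ∣x∣≡2k = suc k , ∣x∣≡2k , s≤s z≤n

self-cancellation-≤ : ∀ x → IsEven x → ¬ x ≡ e → cancellation x x + cancellation x x ≤ len x
self-cancellation-≤ x p x≢e with half-length x p x≢e
... | k , ∣x∣≡2k , 0<k with k ≤? cancellation x x
...   | yes k≤c = ⊥-elim (first-half-not-mirror (proj₁ x) k (proj₂ x) ∣x∣≡2k 0<k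
                            (sym (lcp-take k (reverse (proj₁ x)) (proj₁ x) k≤c)))
...   | no  k≰c = subst (cancellation x x + cancellation x x ≤_) (sym ∣x∣≡2k) (<⇒≤ (+-mono-< (≰⇒> k≰c) (≰⇒> k≰c)))

Reduction-∙ : ∀ {x y} → GeneratingPair x y → len (x · y) < len x → Reduction x y
Reduction-∙ {x} {y} G shorter = record
  { shorter = +-monoˡ-< (len y) shorter
  ; pair    = GeneratingPair-∙ G
  ; reflect = JointlyInverted-∙⁻¹ˡ
  }

Reduction-∙ʳ : ∀ {x y} → GeneratingPair x y → len (x · y) < len y → Reduction x y
Reduction-∙ʳ {x} {y} G shorter = record
  { shorter = +-monoʳ-< (len x) shorter
  ; pair    = GeneratingPair-∙ʳ G
  ; reflect = JointlyInverted-∙⁻¹ʳ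
  }

Reduction-conj : ∀ {x y} g → GeneratingPair x y →
                 len (conj g x) + len (conj g (x · y)) < len x + len y → Reduction x y
Reduction-conj {x} {y} g G shorter = record
  { shorter = shorter
  ; pair    = GeneratingPair-conj g (GeneratingPair-∙ʳ G)
  ; reflect = JointlyInverted-∙⁻¹ʳ
            ∘ JointlyInverted-resp (conj-⁻¹-conj g x) (conj-⁻¹-conj g (x · y))
            ∘ JointlyInverted-conj (g ⁻¹)
  }

take-++ˡ : ∀ k (xs ys : Word) → k ≤ length xs → take k (xs ++ ys) ≡ take k xs
take-++ˡ zero    xs       ys _         = refl
take-++ˡ (suc k) (x ∷ xs) ys (s≤s k≤) = cong (x ∷_) (take-++ˡ k xs ys k≤)

overlap-words : ∀ (y w : Word) k → length y ≡ k + k → k + k ≤ length w →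
                take k (reverse w) ≡ take k y → take k w ≡ take k (reverse y) →
                ∃ λ m → w ≡ reverse (drop k y) ++ (m ++ reverse (take k y))
overlap-words y w k ∣y∣≡2k 2k≤∣w∣ end-w start-w = m , w≡
  where
  open ≡-Reasoning
  p = take k y
  q = drop k y
  w₁ = drop k w
  w≡q⁻¹w₁ : w ≡ reverse q ++ w₁
  w≡q⁻¹w₁ = trans (sym (take++drop≡id k w)) (cong (_++ w₁) (trans start-w (take-half-reverse y k ∣y∣≡2k)))
  k≤∣w₁∣ : k ≤ length (reverse w₁)
  k≤∣w₁∣ = subst (k ≤_) (sym (trans (length-reverse w₁) (length-drop k w))) (m+n≤o⇒m≤o∸n k 2k≤∣w∣)
  end-w₁ : take k (reverse w₁) ≡ p
  end-w₁ = begin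
    take k (reverse w₁)                        ≡⟨ take-++ˡ k (reverse w₁) (reverse (reverse q)) k≤∣w₁∣ ⟨
    take k (reverse w₁ ++ reverse (reverse q)) ≡⟨ cong (take k) (reverse-++ (reverse q) w₁) ⟨
    take k (reverse (reverse q ++ w₁))         ≡⟨ cong (take k ∘ reverse) w≡q⁻¹w₁ ⟨
    take k (reverse w)                         ≡⟨ end-w ⟩
    p                                          ∎
  m = reverse (drop k (reverse w₁))
  w≡ : w ≡ reverse q ++ (m ++ reverse p)
  w≡ = begin
    w                                          ≡⟨ w≡q⁻¹w₁ ⟩
    reverse q ++ w₁                            ≡⟨ cong (reverse q ++_) (reverse-involutive w₁) ⟨
    reverse q ++ reverse (reverse w₁)          ≡⟨ cong (λ t → reverse q ++ reverse t) (take++drop≡id k (reverse w₁)) ⟨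
    reverse q ++ reverse (take k (reverse w₁) ++ drop k (reverse w₁))
                                               ≡⟨ cong (λ t → reverse q ++ reverse (t ++ drop k (reverse w₁))) end-w₁ ⟩
    reverse q ++ reverse (p ++ drop k (reverse w₁)) ≡⟨ cong (reverse q ++_) (reverse-++ p (drop k (reverse w₁))) ⟩
    reverse q ++ (m ++ reverse p)              ∎

record HalfOverlap (y w : Δ) (k : ℕ) : Set where
  field
    P Q M     : Δ
    y≡PQ      : y ≡ P · Q
    w≡Q⁻¹MP⁻¹ : w ≡ Q ⁻¹ · (M · P ⁻¹)
    ∣P∣≡k     : len P ≡ k
    ∣Q∣≡k     : len Q ≡ k
    ∣y∣≡      : len y ≡ k + k
    ∣w∣≡      : len w ≡ k + (len M + k)

half-overlap : ∀ {Y W} k → len Y ≡ k + k → k + k ≤ len W →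
               take k (reverse (proj₁ W)) ≡ take k (proj₁ Y) →
               take k (proj₁ W) ≡ take k (reverse (proj₁ Y)) → HalfOverlap Y W k
half-overlap {Y@(y , ry)} {W@(w , rw)} k ∣y∣≡2k 2k≤∣w∣ end start
  with overlap-words y w k ∣y∣≡2k 2k≤∣w∣ end start
... | m , w≡ = record
  { P = P ; Q = Q ; M = M ; y≡PQ = Y≡PQ ; w≡Q⁻¹MP⁻¹ = W≡Q⁻¹MP⁻¹ ; ∣P∣≡k = ∣p∣≡k ; ∣Q∣≡k = ∣q∣≡k
  ; ∣y∣≡ = ∣y∣≡2k ; ∣w∣≡ = ∣W∣≡ }
  where
  open ≡-Reasoning
  p = take k y
  q = drop k y
  ∣q∣≡k : length q ≡ k
  ∣q∣≡k = length-drop-half y k ∣y∣≡2k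
  ∣p∣≡k : length p ≡ k
  ∣p∣≡k = +-cancelʳ-≡ k (length p) k (begin
    length p + k        ≡⟨ cong (length p +_) ∣q∣≡k ⟨
    length p + length q ≡⟨ length-++ p ⟨
    length (p ++ q)     ≡⟨ cong length (take++drop≡id k y) ⟩
    length y            ≡⟨ ∣y∣≡2k ⟩
    k + k               ∎)
  rpq : Reduced (p ++ q)
  rpq = subst Reduced (sym (take++drop≡id k y)) ry
  rq⁻¹mp⁻¹ : Reduced (reverse q ++ (m ++ reverse p))
  rq⁻¹mp⁻¹ = subst Reduced w≡ rw
  rmp⁻¹ : Reduced (m ++ reverse p)
  rmp⁻¹ = reduced-++ʳ (reverse q) (m ++ reverse p) rq⁻¹mp⁻¹
  P Q M : Δ
  P = p , reduced-++ˡ p q rpq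
  Q = q , reduced-++ʳ p q rpq
  M = m , reduced-++ˡ m (reverse p) rmp⁻¹
  Y≡PQ : Y ≡ P · Q
  Y≡PQ = sym (trans (·-concat p q (proj₂ P) (proj₂ Q) rpq) (Δ-ext (take++drop≡id k y)))
  W≡Q⁻¹MP⁻¹ : W ≡ Q ⁻¹ · (M · P ⁻¹)
  W≡Q⁻¹MP⁻¹ = sym (begin
    Q ⁻¹ · (M · P ⁻¹)                     ≡⟨ cong (Q ⁻¹ ·_) (·-concat m (reverse p) (proj₂ M) (proj₂ (P ⁻¹)) rmp⁻¹) ⟩
    Q ⁻¹ · (m ++ reverse p , rmp⁻¹)       ≡⟨ ·-concat (reverse q) (m ++ reverse p) (proj₂ (Q ⁻¹)) rmp⁻¹ rq⁻¹mp⁻¹ ⟩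
    (reverse q ++ (m ++ reverse p) , _)   ≡⟨ Δ-ext (sym w≡) ⟩
    W                                     ∎)
  ∣W∣≡ : len W ≡ k + (len M + k)
  ∣W∣≡ = begin
    length w                                        ≡⟨ cong length w≡ ⟩
    length (reverse q ++ (m ++ reverse p))          ≡⟨ length-++ (reverse q) ⟩
    length (reverse q) + length (m ++ reverse p)    ≡⟨ cong₂ _+_ (trans (length-reverse q) ∣q∣≡k)
                                                         (trans (length-++ m) (cong (length m +_) (trans (length-reverse p) ∣p∣≡k))) ⟩
    k + (length m + k)                              ∎

-- Conjugation by P⁻¹ turns (y , y w) into the shorter pair (Q P , M).
half-overlap-reduction : ∀ {y w k} → GeneratingPair y w → 0 < k → HalfOverlap y w k → Reduction y w
half-overlap-reduction {y} {w} {k} G 0<k H =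
  Reduction-conj (P ⁻¹) G (subst₂ (λ a b → len a + len b < len y + len w) (sym P⁻¹yP≡QP) (sym P⁻¹ywP≡M) QP,M-shorter)
  where
  open HalfOverlap H
  P⁻¹yP≡QP : conj (P ⁻¹) y ≡ Q · P
  P⁻¹yP≡QP = begin
    P ⁻¹ · y · P ⁻¹ ⁻¹      ≡⟨ cong₂ (λ a b → P ⁻¹ · a · b) y≡PQ (⁻¹-involutive P) ⟩
    P ⁻¹ · (P · Q) · P      ≡⟨ cong (_· P) (\\-leftDividesʳ P Q) ⟩
    Q · P                   ∎
    where open ≡-Reasoning
  P⁻¹ywP≡M : conj (P ⁻¹) (y · w) ≡ M
  P⁻¹ywP≡M = begin
    conj (P ⁻¹) (y · w)                       ≡⟨ cong (conj (P ⁻¹)) (cong₂ _·_ y≡PQ w≡Q⁻¹MP⁻¹) ⟩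
    conj (P ⁻¹) (P · Q · (Q ⁻¹ · (M · P ⁻¹))) ≡⟨ cong (conj (P ⁻¹)) (trans (·-assoc P Q (Q ⁻¹ · (M · P ⁻¹)))
                                                                          (cong (P ·_) (\\-leftDividesˡ Q (M · P ⁻¹)))) ⟩
    conj (P ⁻¹) (P · (M · P ⁻¹))              ≡⟨ cong (conj (P ⁻¹)) (sym (·-assoc P M (P ⁻¹))) ⟩
    conj (P ⁻¹) (conj P M)                    ≡⟨ conj-⁻¹-conj P M ⟩
    M                                         ∎
    where open ≡-Reasoning
  QP,M-shorter : len (Q · P) + len M < len y + len w
  QP,M-shorter = begin-strict
    len (Q · P) + len M           ≤⟨ +-monoˡ-≤ (len M) (subst₂ (λ a b → len (Q · P) ≤ a + b) ∣Q∣≡k ∣P∣≡k (len-·-≤ Q P)) ⟩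
    (k + k) + len M               <⟨ +-monoʳ-< (k + k) (<-≤-trans (m<m+n (len M) 0<k) (m≤n+m (len M + k) k)) ⟩
    (k + k) + (k + (len M + k))   ≡⟨ cong₂ _+_ (sym ∣y∣≡) (sym ∣w∣≡) ⟩
    len y + len w                 ∎
    where open ≤-Reasoning

r-inverts : ∀ i a b → i ≡ a ⊎ i ≡ b → r i · (r a · r b) · r i ≡ (r a · r b) ⁻¹
r-inverts i .i b (inj₁ refl) = involution-∙-inverseˡ {r i} {r b} (r-involution i) (r-involution b)
r-inverts i a .i (inj₂ refl) = involution-∙-inverseʳ {r a} {r i} (r-involution a) (r-involution i)

two-letter : ∀ x → len x ≡ 2 → ∃ λ a → ∃ λ b → ¬ a ≡ b × x ≡ r a · r b
two-letter (a ∷ b ∷ [] , p) _ =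
  a , b , ==-false⇒≢ (proj₁ (reduced-∷∷⁻ a b [] p)) , sym (·-concat (a ∷ []) (b ∷ []) tt tt p)

two-letters-inverted : ∀ {u v} → len u ≡ 2 → len v ≡ 2 → JointlyInverted u v
two-letters-inverted {u} {v} ∣u∣≡2 ∣v∣≡2
  with two-letter u ∣u∣≡2 | two-letter v ∣v∣≡2
... | a , b , a≢b , refl | c , d , c≢d , refl with common-letter a b c d a≢b c≢d
...   | i , i∈ab , i∈cd = record
  { s          = r i
  ; involutive = r-involution i
  ; inverts₁   = r-inverts i a b i∈ab
  ; inverts₂   = r-inverts i c d i∈cd
  }

Searchable : Set → Set₁
Searchable A = ∀ {P : A → Set} → Decidable P → (∀ x → P x) ⊎ ∃ λ x → ¬ P x

symbol-searchable : Searchable Symbol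
symbol-searchable P? with P? (one , false) | P? (one , true) | P? (two , false) | P? (two , true)
... | yes p₁ | yes p₂ | yes p₃ | yes p₄ =
  inj₁ λ { (one , false) → p₁ ; (one , true) → p₂ ; (two , false) → p₃ ; (two , true) → p₄ }
... | no ¬p  | _      | _      | _      = inj₂ (_ , ¬p)
... | yes _  | no ¬p  | _      | _      = inj₂ (_ , ¬p)
... | yes _  | yes _  | no ¬p  | _      = inj₂ (_ , ¬p)
... | yes _  | yes _  | yes _  | no ¬p  = inj₂ (_ , ¬p)

×-searchable : ∀ {A B} → Searchable A → Searchable B → Searchable (A × B)
×-searchable search-A search-B {P} P? with search-A (λ a → all-b? a)
  where
  all-b? : ∀ a → Dec (∀ b → P (a , b))
  all-b? a with search-B (λ b → P? (a , b))
  ... | inj₁ ∀P        = yes ∀P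
  ... | inj₂ (b , ¬Pb) = no (λ ∀P → ¬Pb (∀P b))
... | inj₁ ∀P = inj₁ (λ (a , b) → ∀P a b)
... | inj₂ (a , ¬∀P) with search-B (λ b → P? (a , b))
...   | inj₁ ∀P       = ⊥-elim (¬∀P ∀P)
...   | inj₂ (b , ¬P) = inj₂ ((a , b) , ¬P)

¬→⇒×¬ : ∀ {A B : Set} → Dec A → ¬ (A → B) → A × ¬ B
¬→⇒×¬ (yes a)  ¬f = a , λ b → ¬f (λ _ → b)
¬→⇒×¬ (no ¬a) ¬f = ⊥-elim (¬f (λ a → ⊥-elim (¬a a)))

both-halves : ∀ a b k → a + a ≤ k + k → b + b ≤ k + k → ¬ a + b < k + k → k ≤ a × k ≤ b
both-halves a b k 2a≤2k 2b≤2k ¬a+b<2k = k≤a , k≤b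
  where
  ≤-half : ∀ {m} → m + m ≤ k + k → m ≤ k
  ≤-half {m} 2m≤2k with m ≤? k
  ... | yes m≤k = m≤k
  ... | no  m≰k = ⊥-elim (<⇒≱ (+-mono-< (≰⇒> m≰k) (≰⇒> m≰k)) 2m≤2k)
  k≤a : k ≤ a
  k≤a with k ≤? a
  ... | yes k≤a = k≤a
  ... | no  k≰a = ⊥-elim (¬a+b<2k (+-mono-<-≤ (≰⇒> k≰a) (≤-half 2b≤2k)))
  k≤b : k ≤ b
  k≤b with k ≤? b
  ... | yes k≤b = k≤b
  ... | no  k≰b = ⊥-elim (¬a+b<2k (+-mono-≤-< (≤-half 2a≤2k) (≰⇒> k≰b)))

module _ {u v : Δ} (G : GeneratingPair u v) (u≢e : ¬ u ≡ e) (v≢e : ¬ v ≡ e) where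
  open NielsenConditions u v

  g-even : ∀ x → IsEven (g x)
  g-even = letter-even (even₁ G) (even₂ G)

  private
    ⁻¹≡ε⇒≡ε : ∀ {x} → x ⁻¹ ≡ e → x ≡ e
    ⁻¹≡ε⇒≡ε eq = ⁻¹-injective (trans eq (sym ε⁻¹≈ε))

  g≢e : ∀ x → ¬ g x ≡ e
  g≢e (one , false) = u≢e
  g≢e (one , true)  = u≢e ∘ ⁻¹≡ε⇒≡ε
  g≢e (two , false) = v≢e
  g≢e (two , true)  = v≢e ∘ ⁻¹≡ε⇒≡ε

  letters-generate : ∀ x y → ¬ proj₁ x ≡ proj₁ y → GeneratingPair (g x) (g y)
  letters-generate x y x≁y =
    LetterPairs.letter-pair (λ {u} {v} → GeneratingPair-swap {u} {v}) (λ {u} {v} → GeneratingPair-⁻¹ {u} {v})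
      x y x≁y G

  from-letters : ∀ x y → ¬ proj₁ x ≡ proj₁ y → Reduction (g x) (g y) → Reduction u v
  from-letters =
    LetterPairs.letter-pair⁻ (λ {u} {v} → Reduction-swap {u} {v}) (λ {u} {v} → Reduction-⁻¹ {u} {v})

  long-cancellation-reduction : ∀ x y → ¬ y ≡ x ⁻ →
    ¬ (c x y + c x y ≤ len (g x) × c x y + c x y ≤ len (g y)) → Reduction u v
  long-cancellation-reduction x y y≢x⁻ ¬half with y ≟ₛ x
  ... | yes refl = ⊥-elim (¬half (self , self))
    where self = self-cancellation-≤ (g x) (g-even x) (g≢e x)
  ... | no y≢x with different-generators x y y≢x⁻ y≢x | c x y + c x y ≤? len (g y)
  ...   | x≁y | no 2c≰y = from-letters x y x≁y (Reduction-∙ (letters-generate x y x≁y)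
            (subst (_< len (g x)) (sym (len-· (g x) (g y)))
              (∸+∸-<ˡ (len (g x)) (len (g y)) (c x y) (cancellation-≤ˡ (g x) (g y)) (≰⇒> 2c≰y))))
  ...   | x≁y | yes 2c≤y = from-letters x y x≁y (Reduction-∙ʳ (letters-generate x y x≁y)
            (subst (_< len (g y)) (sym (len-· (g x) (g y)))
              (∸+∸-<ʳ (len (g x)) (len (g y)) (c x y) (cancellation-≤ʳ (g x) (g y))
                (≰⇒> (λ 2c≤x → ¬half (2c≤x , 2c≤y))))))

  g-not-mirror : ∀ y k → len (g y) ≡ k + k → 0 < k →
                 ¬ take k (reverse (proj₁ (g y))) ≡ take k (proj₁ (g y))
  g-not-mirror y k ∣y∣≡2k 0<k = first-half-not-mirror (proj₁ (g y)) k (proj₂ (g y)) ∣y∣≡2k 0<k ∘ sym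

  overlapping-letters : ∀ x y z k → ¬ y ≡ x ⁻ → ¬ z ≡ y ⁻ → len (g y) ≡ k + k → 0 < k →
                        k + k ≤ len (g z) →
                        take k (reverse (proj₁ (g x))) ≡ take k (proj₁ (g y)) →
                        take k (reverse (proj₁ (g y))) ≡ take k (proj₁ (g z)) → Reduction u v
  overlapping-letters x y z k y≢x⁻ z≢y⁻ ∣y∣≡2k 0<k 2k≤∣z∣ end-x start-z
    with x ≟ₛ y | z ≟ₛ y | z ≟ₛ x ⁻
  ... | yes refl | _        | _        = ⊥-elim (g-not-mirror y k ∣y∣≡2k 0<k end-x)
  ... | no _     | yes refl | _        = ⊥-elim (g-not-mirror y k ∣y∣≡2k 0<k start-z)
  ... | no _     | no _     | yes refl =
    ⊥-elim (g-not-mirror y k ∣y∣≡2k 0<k (trans start-z (trans (cong (take k ∘ proj₁) (letter-⁻ u v x)) end-x)))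
  ... | no x≢y   | no z≢y   | no z≢x⁻ with around-letter x y z y≢x⁻ z≢y⁻ x≢y z≢y z≢x⁻
  ...   | refl , y≁x = from-letters y x y≁x
            (half-overlap-reduction (letters-generate y x y≁x) 0<k (half-overlap k ∣y∣≡2k 2k≤∣z∣ end-x (sym start-z)))

  middle-cancelled-reduction : CancelsAtMostHalf → ∀ x y z → ¬ y ≡ x ⁻ → ¬ z ≡ y ⁻ →
                               ¬ c x y + c y z < len (g y) → Reduction u v
  middle-cancelled-reduction half x y z y≢x⁻ z≢y⁻ ¬middle
    with half-length (g y) (g-even y) (g≢e y)
  ... | k , ∣y∣≡2k , 0<k with both-halves (c x y) (c y z) k
                                (subst (c x y + c x y ≤_) ∣y∣≡2k (proj₂ (half x y y≢x⁻)))
                                (subst (c y z + c y z ≤_) ∣y∣≡2k (proj₁ (half y z z≢y⁻)))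
                                (¬middle ∘ subst (c x y + c y z <_) (sym ∣y∣≡2k))
  ...   | k≤cxy , k≤cyz = overlapping-letters x y z k y≢x⁻ z≢y⁻ ∣y∣≡2k 0<k
            (≤-trans (+-mono-≤ k≤cyz k≤cyz) (proj₂ (half y z z≢y⁻)))
            (lcp-take k (reverse (proj₁ (g x))) (proj₁ (g y)) k≤cxy)
            (lcp-take k (reverse (proj₁ (g y))) (proj₁ (g z)) k≤cyz)

  nielsen-reduction : ∀ w → (∀ z → len (g z) ≤ 2 → proj₁ z ≡ w) → Reduction u v
  nielsen-reduction w short⇒w with ×-searchable symbol-searchable symbol-searchable half?
    where
    half? : Decidable λ ((x , y) : Symbol × Symbol) →
              ¬ y ≡ x ⁻ → c x y + c x y ≤ len (g x) × c x y + c x y ≤ len (g y)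
    half? (x , y) = ¬? (y ≟ₛ x ⁻) →-dec ((_ ≤? _) ×-dec (_ ≤? _))
  ... | inj₂ ((x , y) , ¬half) = uncurry (long-cancellation-reduction x y) (¬→⇒×¬ (¬? (y ≟ₛ x ⁻)) ¬half)
  ... | inj₁ half with ×-searchable (×-searchable symbol-searchable symbol-searchable) symbol-searchable middle?
    where
    middle? : Decidable λ (((x , y) , z) : (Symbol × Symbol) × Symbol) →
                ¬ y ≡ x ⁻ → ¬ z ≡ y ⁻ → c x y + c y z < len (g y)
    middle? ((x , y) , z) = ¬? (y ≟ₛ x ⁻) →-dec (¬? (z ≟ₛ y ⁻) →-dec (_ <? _))
  ...   | inj₁ middle = ⊥-elim (nielsen-conditions-fail (generates G) w short⇒w
                                 (λ x y → half (x , y)) (λ x y z → middle ((x , y) , z)))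
  ...   | inj₂ (((x , y) , z) , ¬middle) with ¬→⇒×¬ (¬? (y ≟ₛ x ⁻)) ¬middle
  ...     | y≢x⁻ , ¬middle′ with ¬→⇒×¬ (¬? (z ≟ₛ y ⁻)) ¬middle′
  ...       | z≢y⁻ , ¬middle″ = middle-cancelled-reduction (λ x y → half (x , y)) x y z y≢x⁻ z≢y⁻ ¬middle″

even-length-cases : ∀ x → IsEven x → x ≡ e ⊎ len x ≡ 2 ⊎ 4 ≤ len x
even-length-cases ([] , _)                _  = inj₁ refl
even-length-cases (a ∷ b ∷ [] , _)        _  = inj₂ (inj₁ refl)
even-length-cases (a ∷ b ∷ c ∷ d ∷ w , _) _  = inj₂ (inj₂ (s≤s (s≤s (s≤s (s≤s z≤n)))))

nontrivial-length⇒≢e : ∀ x → len x ≡ 2 ⊎ 4 ≤ len x → ¬ x ≡ e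
nontrivial-length⇒≢e x (inj₁ ()) refl
nontrivial-length⇒≢e x (inj₂ ()) refl

len-signed : ∀ b x → len (signed b x) ≡ len x
len-signed false x = refl
len-signed true  x = len-⁻¹ x

nielsen-step : ∀ {u v} → GeneratingPair u v → Reduction u v ⊎ JointlyInverted u v
nielsen-step {u} {v} G with even-length-cases u (even₁ G) | even-length-cases v (even₂ G)
... | inj₁ refl | _         = ⊥-elim (commuting-pair-⊥ (trans (·-identityˡ v) (sym (·-identityʳ v))) (generates G))
... | inj₂ _    | inj₁ refl = ⊥-elim (commuting-pair-⊥ (trans (·-identityʳ u) (sym (·-identityˡ u))) (generates G))
... | inj₂ (inj₁ ∣u∣≡2) | inj₂ (inj₁ ∣v∣≡2) = inj₂ (two-letters-inverted ∣u∣≡2 ∣v∣≡2)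
... | inj₂ (inj₂ 4≤∣u∣) | inj₂ v-cases = inj₁
  (nielsen-reduction G (nontrivial-length⇒≢e u (inj₂ 4≤∣u∣)) (nontrivial-length⇒≢e v v-cases) two short⇒two)
  where
  short⇒two : ∀ z → len (letter u v z) ≤ 2 → proj₁ z ≡ two
  short⇒two (one , b) ≤2 = ⊥-elim (<⇒≱ (s≤s (s≤s (s≤s z≤n)))
                                        (≤-trans 4≤∣u∣ (subst (_≤ 2) (len-signed b u) ≤2)))
  short⇒two (two , b) _  = refl
... | inj₂ (inj₁ ∣u∣≡2) | inj₂ (inj₂ 4≤∣v∣) = inj₁
  (nielsen-reduction G (nontrivial-length⇒≢e u (inj₁ ∣u∣≡2)) (nontrivial-length⇒≢e v (inj₂ 4≤∣v∣)) one short⇒one)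
  where
  short⇒one : ∀ z → len (letter u v z) ≤ 2 → proj₁ z ≡ one
  short⇒one (one , b) _  = refl
  short⇒one (two , b) ≤2 = ⊥-elim (<⇒≱ (s≤s (s≤s (s≤s z≤n)))
                                        (≤-trans 4≤∣v∣ (subst (_≤ 2) (len-signed b v) ≤2)))

generating-pair-inverted : ∀ {u v} → GeneratingPair u v → JointlyInverted u v
generating-pair-inverted G = <-rec Inverted induction-step _ refl G
  where
  Inverted : ℕ → Set
  Inverted n = ∀ {u v} → len u + len v ≡ n → GeneratingPair u v → JointlyInverted u v
  induction-step : ∀ n → (∀ {m} → m < n → Inverted m) → Inverted n
  induction-step n IH refl G with nielsen-step G
  ... | inj₁ R = reflect R (IH (shorter R) refl (pair R))
  ... | inj₂ I = I

-- Surjectivity of the restriction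

pair-in-span : ∀ i j → ¬ i ≡ j → InSpan ρ₂ ρ₀ (r i · r j)
pair-in-span zero             zero             i≢j = ⊥-elim (i≢j refl)
pair-in-span zero             (suc zero)       _   = (one , false) ∷ [] , refl
pair-in-span zero             (suc (suc zero)) _   = (one , false) ∷ (two , false) ∷ [] , refl
pair-in-span (suc zero)       zero             _   = (one , true) ∷ [] , refl
pair-in-span (suc zero)       (suc zero)       i≢j = ⊥-elim (i≢j refl)
pair-in-span (suc zero)       (suc (suc zero)) _   = (two , false) ∷ [] , refl
pair-in-span (suc (suc zero)) zero             _   = (two , true) ∷ (one , true) ∷ [] , refl
pair-in-span (suc (suc zero)) (suc zero)       _   = (two , true) ∷ [] , refl
pair-in-span (suc (suc zero)) (suc (suc zero)) i≢j = ⊥-elim (i≢j refl)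

ρ₂ρ₀-generate : Generates ρ₂ ρ₀
ρ₂ρ₀-generate (w , p) even = word-in-span w p even
  where
  word-in-span : ∀ w (p : Reduced w) → T (evenL w) → InSpan ρ₂ ρ₀ (w , p)
  word-in-span []          _ _    = span-ε
  word-in-span (i ∷ j ∷ w) p even =
    span-resp w≡ (span-∙ (pair-in-span i j (==-false⇒≢ (proj₁ i≠j,p′))) (word-in-span w p″ even′))
    where
    i≠j,p′ = reduced-∷∷⁻ i j w p
    p″ = reduced-tail′ j w (proj₂ i≠j,p′)
    even′ : T (evenL w)
    even′ = subst T (not-involutive (evenL w)) even
    pij : Reduced (i ∷ j ∷ [])
    pij = reduced-++ˡ (i ∷ j ∷ []) w p
    w≡ : r i · r j · (w , p″) ≡ (i ∷ j ∷ w , p)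
    w≡ = trans (cong (_· (w , p″)) (·-concat (i ∷ []) (j ∷ []) tt tt pij))
               (·-concat (i ∷ j ∷ []) w pij p″ p)

r₁ : Δ
r₁ = r (suc zero)

module Extension (β : AutΔ⁺) where

  -- β and β⁻¹ as maps on even elements, with the evenness proof irrelevant so that
  -- rewriting the element never requires transporting it.
  β⁺ β⁻ : (x : Δ) → .(IsEven x) → Δ
  β⁺ x p = proj₁ (fun β (x , recompute (T? _) p))
  β⁻ x p = proj₁ (inv β (x , recompute (T? _) p))

  β⁺-even : ∀ x .p → IsEven (β⁺ x p)
  β⁺-even x p = proj₂ (fun β (x , recompute (T? _) p))

  β⁻-even : ∀ x .p → IsEven (β⁻ x p)
  β⁻-even x p = proj₂ (inv β (x , recompute (T? _) p))

  β⁺-cong : ∀ {x y} .{p q} → x ≡ y → β⁺ x p ≡ β⁺ y q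
  β⁺-cong refl = refl

  β⁻-cong : ∀ {x y} .{p q} → x ≡ y → β⁻ x p ≡ β⁻ y q
  β⁻-cong refl = refl

  β⁺-fun : ∀ x .p (q : IsEven x) → β⁺ x p ≡ proj₁ (fun β (x , q))
  β⁺-fun x p q = cong (proj₁ ∘ fun β) (Δ⁺-ext refl)

  β⁻-inv : ∀ x .p (q : IsEven x) → β⁻ x p ≡ proj₁ (inv β (x , q))
  β⁻-inv x p q = cong (proj₁ ∘ inv β) (Δ⁺-ext refl)

  β⁺-· : ∀ x y (p : IsEven x) (q : IsEven y) → β⁺ (x · y) (even-· x y p q) ≡ β⁺ x p · β⁺ y q
  β⁺-· x y p q = trans (β⁺-fun (x · y) _ (even-· x y p q))
    (trans (cong proj₁ (hom β (x , p) (y , q))) (sym (cong₂ _·_ (β⁺-fun x p p) (β⁺-fun y q q))))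

  β⁺-β⁻ : ∀ y .p .q → β⁺ (β⁻ y p) q ≡ y
  β⁺-β⁻ y p q = trans (β⁺-fun _ q (β⁻-even y p)) (cong proj₁ (rinv β (y , recompute (T? _) p)))

  β⁻-β⁺ : ∀ x .p .q → β⁻ (β⁺ x p) q ≡ x
  β⁻-β⁺ x p q = trans (β⁻-inv _ q (β⁺-even x p)) (cong proj₁ (linv β (x , recompute (T? _) p)))

  β⁺-e : β⁺ e tt ≡ e
  β⁺-e = identityʳ-unique (β⁺ e tt) (β⁺ e tt) (trans (sym (β⁺-· e e tt tt)) (β⁺-cong (·-identityˡ e)))

  β⁺-⁻¹ : ∀ x (p : IsEven x) → β⁺ (x ⁻¹) (even-⁻¹ x p) ≡ β⁺ x p ⁻¹
  β⁺-⁻¹ x p = inverseʳ-unique (β⁺ x p) (β⁺ (x ⁻¹) (even-⁻¹ x p))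
    (trans (sym (β⁺-· x (x ⁻¹) p (even-⁻¹ x p))) (trans (β⁺-cong (·-inverseʳ x)) β⁺-e))

  β⁺-eval : ∀ a b (p : IsEven a) (q : IsEven b) L →
            β⁺ (eval a b L) (eval-even p q L) ≡ eval (β⁺ a p) (β⁺ b q) L
  β⁺-eval a b p q []      = β⁺-e
  β⁺-eval a b p q (x ∷ L) =
    trans (β⁺-· (letter a b x) (eval a b L) (letter-even p q x) (eval-even p q L))
          (cong₂ _·_ (letter-β⁺ x) (β⁺-eval a b p q L))
    where
    letter-β⁺ : ∀ x → β⁺ (letter a b x) (letter-even p q x) ≡ letter (β⁺ a p) (β⁺ b q) x
    letter-β⁺ (one , false) = refl
    letter-β⁺ (one , true)  = β⁺-⁻¹ a p
    letter-β⁺ (two , false) = refl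
    letter-β⁺ (two , true)  = β⁺-⁻¹ b q

  u v : Δ
  u = β⁺ ρ₂ tt
  v = β⁺ ρ₀ tt

  uv-generating : GeneratingPair u v
  uv-generating = record
    { even₁     = β⁺-even ρ₂ tt
    ; even₂     = β⁺-even ρ₀ tt
    ; generates = λ x p → let (L , eq) = ρ₂ρ₀-generate (β⁻ x p) (β⁻-even x p) in
        L , trans (sym (β⁺-eval ρ₂ ρ₀ tt tt L))
                  (trans (β⁺-cong eq) (β⁺-β⁻ x p (β⁻-even x p)))
    }
    where open GeneratingPair

  -- The involution is kept abstract so that no proof unfolds the Nielsen reduction.
  module _ (I : JointlyInverted u v) where

    open JointlyInverted I

    s-odd : IsOdd s
    s-odd = involution-odd s involutive s≢e
      where
      u≢e : ¬ u ≡ e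
      u≢e u≡e = ρ₂≢e (begin
        ρ₂               ≡⟨ β⁻-β⁺ ρ₂ tt (β⁺-even ρ₂ tt) ⟨
        β⁻ u (β⁺-even ρ₂ tt) ≡⟨ β⁻-cong {q = β⁺-even e tt} (trans u≡e (sym β⁺-e)) ⟩
        β⁻ (β⁺ e tt) _   ≡⟨ β⁻-β⁺ e tt (β⁺-even e tt) ⟩
        e                ∎)
        where open ≡-Reasoning
      s≢e : ¬ s ≡ e
      s≢e s≡e = even-odd-⊥ u (β⁺-even ρ₂ tt) (involution-odd u uu≡e u≢e)
        where
        u≡u⁻¹ : u ≡ u ⁻¹
        u≡u⁻¹ = trans (sym (trans (·-identityʳ (e · u)) (·-identityˡ u)))
                      (trans (cong (λ t → t · u · t) (sym s≡e)) inverts₁)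
        uu≡e : u · u ≡ e
        uu≡e = trans (cong (u ·_) u≡u⁻¹) (·-inverseʳ u)

    -- Conjugation by s on the image corresponds to conjugation by r₁, since both invert the generators.
    s-conj : ∀ y (p : IsEven y) → s · β⁺ y p · s ≡ β⁺ (r₁ · y · r₁) (even-conj r₁ y p)
    s-conj y p with ρ₂ρ₀-generate y p
    ... | L , refl = begin
      s · β⁺ (eval ρ₂ ρ₀ L) p · s          ≡⟨ cong (λ t → s · t · s) (β⁺-eval ρ₂ ρ₀ tt tt L) ⟩
      s · eval u v L · s                   ≡⟨ conj-involution {s} involutive (eval u v L) ⟨
      conj s (eval u v L)                  ≡⟨ eval-conj s u v L ⟨
      eval (conj s u) (conj s v) L         ≡⟨ cong₂ (λ a b → eval a b L) (inverted inverts₁) (inverted inverts₂) ⟩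
      eval (u ⁻¹) (v ⁻¹) L                 ≡⟨ cong₂ (λ a b → eval a b L) (β⁺-⁻¹ ρ₂ tt) (β⁺-⁻¹ ρ₀ tt) ⟨
      eval (β⁺ (ρ₂ ⁻¹) tt) (β⁺ (ρ₀ ⁻¹) tt) L ≡⟨ β⁺-eval (ρ₂ ⁻¹) (ρ₀ ⁻¹) tt tt L ⟨
      β⁺ (eval (conj r₁ ρ₂) (conj r₁ ρ₀) L) _ ≡⟨ β⁺-cong (eval-conj r₁ ρ₂ ρ₀ L) ⟩
      β⁺ (r₁ · eval ρ₂ ρ₀ L · r₁) _         ∎
      where
      open ≡-Reasoning
      inverted : ∀ {x} → s · x · s ≡ x ⁻¹ → conj s x ≡ x ⁻¹
      inverted {x} = trans (conj-involution {s} involutive x)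

    odd·r₁ : ∀ x → IsOdd x → IsEven (x · r₁)
    odd·r₁ x o = odd-·-odd x r₁ o tt

    odd·s : ∀ y → IsOdd y → IsEven (y · s)
    odd·s y o = odd-·-odd y s o s-odd

    -- On odd elements x = (x r₁) r₁ the extension is forced: α x = β (x r₁) · s.
    extend : Δ → Δ
    extend x with parity-cases x
    ... | inj₁ p = β⁺ x p
    ... | inj₂ o = β⁺ (x · r₁) (odd·r₁ x o) · s

    retract : Δ → Δ
    retract y with parity-cases y
    ... | inj₁ p = β⁻ y p
    ... | inj₂ o = β⁻ (y · s) (odd·s y o) · r₁

    extend-even : ∀ x (p : IsEven x) → extend x ≡ β⁺ x p
    extend-even x p with parity-cases x
    ... | inj₁ _ = refl
    ... | inj₂ o = ⊥-elim (even-odd-⊥ x p o)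

    extend-odd : ∀ x (o : IsOdd x) → extend x ≡ β⁺ (x · r₁) (odd·r₁ x o) · s
    extend-odd x o with parity-cases x
    ... | inj₁ p = ⊥-elim (even-odd-⊥ x p o)
    ... | inj₂ _ = refl

    retract-even : ∀ y (p : IsEven y) → retract y ≡ β⁻ y p
    retract-even y p with parity-cases y
    ... | inj₁ _ = refl
    ... | inj₂ o = ⊥-elim (even-odd-⊥ y p o)

    retract-odd : ∀ y (o : IsOdd y) → retract y ≡ β⁻ (y · s) (odd·s y o) · r₁
    retract-odd y o with parity-cases y
    ... | inj₁ p = ⊥-elim (even-odd-⊥ y p o)
    ... | inj₂ _ = refl

    private
      open MonoidSolver (Group.monoid Δ-group) using (solve; _⊜_; _⊕_)

      cancel-involution : ∀ {t} → t · t ≡ e → ∀ a → a · t · t ≡ a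
      cancel-involution {t} tt≡e a = trans (·-assoc a t t) (trans (cong (a ·_) tt≡e) (·-identityʳ a))

      r₁r₁ : r₁ · r₁ ≡ e
      r₁r₁ = r-involution (suc zero)

      conj-split : ∀ x y → x · y · r₁ ≡ x · r₁ · (r₁ · y · r₁)
      conj-split x y = begin
        x · y · r₁                 ≡⟨ cong (λ t → t · y · r₁) (cancel-involution r₁r₁ x) ⟨
        x · r₁ · r₁ · y · r₁       ≡⟨ solve 3 (λ x r y → (((x ⊕ r) ⊕ r) ⊕ y) ⊕ r ⊜ (x ⊕ r) ⊕ ((r ⊕ y) ⊕ r)) refl x r₁ y ⟩
        x · r₁ · (r₁ · y · r₁)     ∎
        where open ≡-Reasoning

    extend-·-even-even : ∀ x y (p : IsEven x) (q : IsEven y) → extend (x · y) ≡ extend x · extend y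
    extend-·-even-even x y p q = begin
      extend (x · y)                    ≡⟨ extend-even (x · y) (even-· x y p q) ⟩
      β⁺ (x · y) (even-· x y p q)       ≡⟨ β⁺-· x y p q ⟩
      β⁺ x p · β⁺ y q                   ≡⟨ cong₂ _·_ (extend-even x p) (extend-even y q) ⟨
      extend x · extend y               ∎
      where open ≡-Reasoning

    extend-·-even-odd : ∀ x y (p : IsEven x) (o : IsOdd y) → extend (x · y) ≡ extend x · extend y
    extend-·-even-odd x y p o = begin
      extend (x · y)                                       ≡⟨ extend-odd (x · y) (even-·-odd x y p o) ⟩
      β⁺ (x · y · r₁) (odd·r₁ (x · y) (even-·-odd x y p o)) · s ≡⟨ cong (_· s) (β⁺-cong (·-assoc x y r₁)) ⟩
      β⁺ (x · (y · r₁)) (even-· x (y · r₁) p (odd·r₁ y o)) · s ≡⟨ cong (_· s) (β⁺-· x (y · r₁) p (odd·r₁ y o)) ⟩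
      β⁺ x p · b · s                                       ≡⟨ ·-assoc (β⁺ x p) b s ⟩
      β⁺ x p · (b · s)                                     ≡⟨ cong₂ _·_ (extend-even x p) (extend-odd y o) ⟨
      extend x · extend y                                  ∎
      where
      open ≡-Reasoning
      b = β⁺ (y · r₁) (odd·r₁ y o)

    extend-·-odd-even : ∀ x y (o : IsOdd x) (q : IsEven y) → extend (x · y) ≡ extend x · extend y
    extend-·-odd-even x y o q = begin
      extend (x · y)                                       ≡⟨ extend-odd (x · y) (odd-·-even x y o q) ⟩
      β⁺ (x · y · r₁) (odd·r₁ (x · y) (odd-·-even x y o q)) · s
        ≡⟨ cong (_· s) (β⁺-cong (conj-split x y)) ⟩
      β⁺ (x · r₁ · (r₁ · y · r₁)) (even-· (x · r₁) (r₁ · y · r₁) (odd·r₁ x o) (even-conj r₁ y q)) · s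
        ≡⟨ cong (_· s) (β⁺-· (x · r₁) (r₁ · y · r₁) (odd·r₁ x o) (even-conj r₁ y q)) ⟩
      a · β⁺ (r₁ · y · r₁) (even-conj r₁ y q) · s          ≡⟨ cong (λ t → a · t · s) (s-conj y q) ⟨
      a · (s · β⁺ y q · s) · s
        ≡⟨ solve 3 (λ a s b → ((a ⊕ ((s ⊕ b) ⊕ s)) ⊕ s) ⊜ ((a ⊕ s) ⊕ b) ⊕ (s ⊕ s)) refl a s (β⁺ y q) ⟩
      a · s · β⁺ y q · (s · s)                             ≡⟨ trans (cong (a · s · β⁺ y q ·_) involutive) (·-identityʳ _) ⟩
      a · s · β⁺ y q                                       ≡⟨ cong₂ _·_ (extend-odd x o) (extend-even y q) ⟨
      extend x · extend y                                  ∎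
      where
      open ≡-Reasoning
      a = β⁺ (x · r₁) (odd·r₁ x o)

    extend-·-odd-odd : ∀ x y (o : IsOdd x) (o′ : IsOdd y) → extend (x · y) ≡ extend x · extend y
    extend-·-odd-odd x y o o′ = begin
      extend (x · y)                                       ≡⟨ extend-even (x · y) (odd-·-odd x y o o′) ⟩
      β⁺ (x · y) (odd-·-odd x y o o′)                      ≡⟨ β⁺-cong (trans (sym (cancel-involution r₁r₁ (x · y)))
                                                                  (trans (cong (_· r₁) (·-assoc x y r₁)) (conj-split x (y · r₁)))) ⟩
      β⁺ (x · r₁ · (r₁ · (y · r₁) · r₁)) (even-· (x · r₁) (r₁ · (y · r₁) · r₁) (odd·r₁ x o) (even-conj r₁ (y · r₁) (odd·r₁ y o′)))
        ≡⟨ β⁺-· (x · r₁) (r₁ · (y · r₁) · r₁) (odd·r₁ x o) (even-conj r₁ (y · r₁) (odd·r₁ y o′)) ⟩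
      a · β⁺ (r₁ · (y · r₁) · r₁) (even-conj r₁ (y · r₁) (odd·r₁ y o′))
        ≡⟨ cong (a ·_) (s-conj (y · r₁) (odd·r₁ y o′)) ⟨
      a · (s · b · s)
        ≡⟨ solve 3 (λ a s b → a ⊕ ((s ⊕ b) ⊕ s) ⊜ (a ⊕ s) ⊕ (b ⊕ s)) refl a s b ⟩
      a · s · (b · s)                                      ≡⟨ cong₂ _·_ (extend-odd x o) (extend-odd y o′) ⟨
      extend x · extend y                                  ∎
      where
      open ≡-Reasoning
      a = β⁺ (x · r₁) (odd·r₁ x o)
      b = β⁺ (y · r₁) (odd·r₁ y o′)

    extend-· : ∀ x y → extend (x · y) ≡ extend x · extend y
    extend-· x y = by-parity (parity-cases x) (parity-cases y)
      where
      by-parity : IsEven x ⊎ IsOdd x → IsEven y ⊎ IsOdd y → extend (x · y) ≡ extend x · extend y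
      by-parity (inj₁ p) (inj₁ q)  = extend-·-even-even x y p q
      by-parity (inj₁ p) (inj₂ o)  = extend-·-even-odd x y p o
      by-parity (inj₂ o) (inj₁ q)  = extend-·-odd-even x y o q
      by-parity (inj₂ o) (inj₂ o′) = extend-·-odd-odd x y o o′

    retract-extend : ∀ x → retract (extend x) ≡ x
    retract-extend x with parity-cases x
    ... | inj₁ p = trans (retract-even (β⁺ x p) (β⁺-even x p)) (β⁻-β⁺ x p (β⁺-even x p))
    ... | inj₂ o = begin
      retract (a · s)
        ≡⟨ retract-odd (a · s) (even-·-odd a s (β⁺-even (x · r₁) (odd·r₁ x o)) s-odd) ⟩
      β⁻ (a · s · s) _ · r₁
        ≡⟨ cong (_· r₁) (β⁻-cong {q = β⁺-even (x · r₁) (odd·r₁ x o)} (cancel-involution {s} involutive a)) ⟩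
      β⁻ a (β⁺-even (x · r₁) (odd·r₁ x o)) · r₁
        ≡⟨ cong (_· r₁) (β⁻-β⁺ (x · r₁) (odd·r₁ x o) (β⁺-even (x · r₁) (odd·r₁ x o))) ⟩
      x · r₁ · r₁                                   ≡⟨ cancel-involution r₁r₁ x ⟩
      x                                             ∎
      where
      open ≡-Reasoning
      a = β⁺ (x · r₁) (odd·r₁ x o)

    extend-retract : ∀ y → extend (retract y) ≡ y
    extend-retract y with parity-cases y
    ... | inj₁ p = trans (extend-even (β⁻ y p) (β⁻-even y p)) (β⁺-β⁻ y p (β⁻-even y p))
    ... | inj₂ o = begin
      extend (b · r₁)
        ≡⟨ extend-odd (b · r₁) (even-·-odd b r₁ (β⁻-even (y · s) (odd·s y o)) tt) ⟩
      β⁺ (b · r₁ · r₁) _ · s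
        ≡⟨ cong (_· s) (β⁺-cong {q = β⁻-even (y · s) (odd·s y o)} (cancel-involution r₁r₁ b)) ⟩
      β⁺ b (β⁻-even (y · s) (odd·s y o)) · s
        ≡⟨ cong (_· s) (β⁺-β⁻ (y · s) (odd·s y o) (β⁻-even (y · s) (odd·s y o))) ⟩
      y · s · s                                     ≡⟨ cancel-involution {s} involutive y ⟩
      y                                             ∎
      where
      open ≡-Reasoning
      b = β⁻ (y · s) (odd·s y o)

    extension : AutΔ
    extension = record
      { fun  = extend
      ; inv  = retract
      ; hom  = extend-·
      ; linv = retract-extend
      ; rinv = extend-retract
      }

    extension-restricts : Restricts extension β
    extension-restricts x p = sym (trans (extend-even x p) (β⁺-fun x p p))

restriction-surjective : (β : AutΔ⁺) → Σ AutΔ (λ α → Restricts α β)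
restriction-surjective β = extension I , extension-restricts I
  where
  open Extension β
  I : JointlyInverted u v
  I = generating-pair-inverted uv-generating

proposition2p1 :
    ((α : AutΔ) → Σ AutΔ⁺ (λ β → Restricts α β))
  × ((α α′ : AutΔ) (β β′ : AutΔ⁺) → Restricts α β → Restricts α′ β′
       → Restricts (α ∘ᴬ α′) (β ∘ᴬ β′))
  × ((α α′ : AutΔ) (β : AutΔ⁺) → Restricts α β → Restricts α′ β
       → (x : Δ) → fun α x ≡ fun α′ x)
  × ((β : AutΔ⁺) → Σ AutΔ (λ α → Restricts α β))
proposition2p1 =
  (λ α → restriction α , restriction-restricts α) , restricts-∘ , restriction-injective , restriction-surjective
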